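{- Let $q>2$ and $n\ge 1$ be integers, let $h\in\{0,1,\ldots,n\}$ and $\lambda=(q-1)n-qh$, and let $f:\mathbf{F}_q^n\to\mathbb{C}$ be a $\lambda$-function. Let $I\subseteq\{1,\ldots,n\}$ with $|I|=k\le\min\{h,n-h\}$, and let $\overline{I}=\{1,\ldots,n\}\setminus I$. Then for every $\alpha\in\mathbf{F}_q^n$ and every $j=0,\ldots,n-k$, $$v_j^{\overline{I},f}(\alpha)=\sum_{i=0}^{j} r_{ij}\, v_i^{I,f}(\alpha),\qquad\text{where}\qquad r_{ij}=(-1)^i\sum_{l=0}^{j-i}P^{(q)}_{j-i-l}(h-k;\,n-2k)\,(q-2)^l\binom{k-i}{l}.$$
   Context: $\mathbf{F}_q=\{0,1,\ldots,q-1\}$ is the additive group of integers modulo $q$, and $\mathbf{F}_q^n$ is the vertex set of the $q$-ary $n$-dimensional Hamming graph (two vectors are adjacent iff they differ in exactly one coordinate). $\rho(\alpha,\beta)$ is the Hamming distance (number of coordinates where $\alpha,\beta$ differ). For $\alpha\in\mathbf{F}_q^n$, $W_1(\alpha)=\{\beta:\rho(\alpha,\beta)=1\}$. A function $f:\mathbf{F}_q^n\to\mathbb{C}$ is a $\lambda$-function if $\sum_{\beta\in W_1(\alpha)}f(\beta)=\lambda f(\alpha)$ for all $\alpha$. For $J\subseteq\{1,\ldots,n\}$ and $\alpha\in\mathbf{F}_q^n$, the face is $\Gamma^J(\alpha)=\{\beta\in\mathbf{F}_q^n:\beta_i=\alpha_i\ \forall i\notin J\}$, and the local distribution components are $v_j^{J,f}(\alpha)=\sum_{\beta\in\Gamma^J(\alpha),\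 \rho(\alpha,\beta)=j}f(\beta)$ for integers $j\ge 0$ (this is $0$ when $j>|J|$). The Krawtchouk polynomial is $P^{(q)}_i(t;N)=\sum_{s=0}^{i}(-1)^s(q-1)^{i-s}\binom{t}{s}\binom{N-t}{i-s}$. Binomial coefficients $\binom{a}{b}$ with $b>a\ge 0$ or $b<0$ are $0$; an empty sum is $0$. -}

module Defs where

open import Level using (Level)
open import Data.Bool using (Bool; true; false; not; _∧_; _∨_; if_then_else_)
open import Data.Nat as ℕ using (ℕ; zero; suc; _∸_)
open import Data.Nat.Combinatorics using (_C_)
open import Data.Integer as ℤ using (ℤ; +_; -[1+_])
open import Data.Fin using (Fin; zero; suc; _≟_)
open import Data.Fin.Subset using (Subset)
open import Data.Vec using (lookup)
open import Data.List using (List; []; _∷_; [_]; map; concatMap; allFin; filter; foldr; length)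
open import Data.Bool.ListAction using (and)
open import Relation.Nullary.Decidable using (⌊_⌋)
open import Algebra.Bundles using (CommutativeRing)

-- Vertices of the q-ary n-dimensional Hamming graph: F_q^n, with F_q = Fin q.
Vtx : ℕ → ℕ → Set
Vtx q n = Fin n → Fin q

cons : ∀ {q n} → Fin q → Vtx q n → Vtx q (suc n)
cons a v zero    = a
cons a v (suc i) = v i

allVtx : (q n : ℕ) → List (Vtx q n)
allVtx q zero    = [ (λ ()) ]
allVtx q (suc n) = concatMap (λ a → map (cons a) (allVtx q n)) (allFin q)

_==_ : ∀ {q} → Fin q → Fin q → Bool
a == b = ⌊ a ≟ b ⌋

ρ : ∀ {q n} → Vtx q n → Vtx q n → ℕ
ρ {n = n} α β = length (filter (λ i → not (α i == β i) ≟b true) (allFin n))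
  where
  open import Data.Bool.Properties renaming (_≟_ to _≟b_)

-- β ∈ Γ^J(α) : β_i = α_i for all i ∉ J.
inFace : ∀ {q n} → Subset n → Vtx q n → Vtx q n → Bool
inFace {n = n} J α β = and (map (λ i → lookup J i ∨ (β i == α i)) (allFin n))

Σℤ : ℕ → (ℕ → ℤ) → ℤ
Σℤ zero    g = g zero
Σℤ (suc i) g = Σℤ i g ℤ.+ g (suc i)

powℤ : ℤ → ℕ → ℤ
powℤ x zero    = + 1
powℤ x (suc m) = x ℤ.* powℤ x m

sgn : ℕ → ℤ
sgn s = powℤ (ℤ.- (+ 1)) s

Kraw : (q i t N : ℕ) → ℤ
Kraw q i t N = Σℤ i (λ s → sgn s ℤ.* powℤ (+ (q ∸ 1)) (i ∸ s)
                          ℤ.* (+ (t C s)) ℤ.* (+ ((N ∸ t) C (i ∸ s))))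

r : (q n h k i j : ℕ) → ℤ
r q n h k i j = sgn i ℤ.* Σℤ (j ∸ i) (λ l →
                  Kraw q (j ∸ i ∸ l) (h ∸ k) (n ∸ (2 ℕ.* k))
                  ℤ.* powℤ (+ (q ∸ 2)) l ℤ.* (+ ((k ∸ i) C l)))

lam : (q n h : ℕ) → ℤ
lam q n h = (+ ((q ∸ 1) ℕ.* n)) ℤ.- (+ (q ℕ.* h))

module WithRing {c ℓ : Level} (R : CommutativeRing c ℓ) where
  open CommutativeRing R using (Carrier; _≈_; _+_; _*_; -_; 0#; 1#)

  ΣL : ∀ {A : Set} → List A → (A → Carrier) → Carrier
  ΣL xs g = foldr (λ x acc → g x + acc) 0# xs

  ΣR : ℕ → (ℕ → Carrier) → Carrier
  ΣR zero    g = g zero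
  ΣR (suc i) g = ΣR i g + g (suc i)

  fromℕ : ℕ → Carrier
  fromℕ zero    = 0#
  fromℕ (suc m) = 1# + fromℕ m

  fromℤ : ℤ → Carrier
  fromℤ (+ m)      = fromℕ m
  fromℤ -[1+ m ]   = - fromℕ (suc m)

  sumW1 : ∀ {q n} → (Vtx q n → Carrier) → Vtx q n → Carrier
  sumW1 {q} {n} f α = ΣL (filter (λ β → ρ α β ℕ.≟ 1) (allVtx q n)) f

  IsLambdaFunction : ∀ {q n} → ℤ → (Vtx q n → Carrier) → Set ℓ
  IsLambdaFunction {q} {n} λ' f = ∀ α → sumW1 f α ≈ fromℤ λ' * f α

  v : ∀ {q n} → ℕ → Subset n → (Vtx q n → Carrier) → Vtx q n → Carrier
  v {q} {n} j J f α =
    ΣL (filter (λ β → (inFace J α β ∧ ⌊ ρ α β ℕ.≟ j ⌋) Data.Bool.Properties.≟ true)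
               (allVtx q n)) f
    where import Data.Bool.Properties

  TorsionFree : Set (c Level.⊔ ℓ)
  TorsionFree = ∀ (m : ℕ) (x : Carrier) → fromℕ (suc m) * x ≈ 0# → x ≈ 0#

module Submission where

-- Every vertex β has a distance profile (a, b) = (ρ(α,β) restricted to I,
-- ρ(α,β) restricted to ∁I).  For φ : ℕ → ℕ → R put  W φ = Σ_β φ(a_β, b_β) f(β).
--  (1) Counting neighbours (HammingSums) gives  λ · W φ = W (L φ)  for an explicit
--      operator L acting by three-term recurrences in a and in b.
--  (2) The products K_u(a;k) K_s(b;m) of Krawtchouk polynomials (m = n-k) are
--      eigenfunctions of L (Krawtchouk.Kraw-recurrence) with eigenvalue
--      λ - q(u+s-h); R being torsion-free, their W-value vanishes unless u+s = h.
--  (3) Krawtchouk orthogonality writes every point mass δ_{(a₀,b₀)} through these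
--      eigenfunctions, so  q^n · W δ_{(a₀,b₀)} = Σ_u K_{a₀}(u) K_{b₀}(h-u) W(K_u K_{h-u}).
--  (4) v_j^{∁I}(α) = W δ_{(0,j)} and v_i^I(α) = W δ_{(i,0)}; the generating-function
--      identity Σ_i r_{ij} K_i(u;k) = K_j(h-u; n-k) (Reduction) shows both
--      sides of the claim agree after multiplication by q^n, which then cancels.
-- Krawtchouk polynomials are handled through  Σ_i K_i(t;N) y^i = (1-y)^t (1+(q-1)y)^{N-t}
-- in a small polynomial ring over ℤ.

open import Defs
open import Level using (Level)
open import Data.Nat using (ℕ; _<_; _≤_; _∸_)
open import Data.Fin.Subset using (Subset; ∣_∣; ∁)
open import Algebra.Bundles using (CommutativeRing)

module IntegerSums where

  open import Data.Nat using (ℕ; zero; suc; _∸_; z≤n; _≤_; _<_)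
  import Data.Nat.Properties as ℕP
  open import Data.Integer using (ℤ; _+_; _*_; 0ℤ)
  import Data.Integer.Properties as ℤP
  open import Relation.Binary.PropositionalEquality
  open import Relation.Nullary using (yes; no)
  open import Function using (_∘_)

  Σℤ-cong : ∀ i {g g' : ℕ → ℤ} → (∀ s → s ≤ i → g s ≡ g' s) → Σℤ i g ≡ Σℤ i g'
  Σℤ-cong zero e = e zero z≤n
  Σℤ-cong (suc i) e = cong₂ _+_ (Σℤ-cong i (λ s s≤ → e s (ℕP.m≤n⇒m≤1+n s≤))) (e (suc i) ℕP.≤-refl)

  Σℤ-peel : ∀ i (g : ℕ → ℤ) → Σℤ (suc i) g ≡ g 0 + Σℤ i (g ∘ suc)
  Σℤ-peel zero g = refl
  Σℤ-peel (suc i) g = trans (cong (_+ g (suc (suc i))) (Σℤ-peel i g))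
                            (ℤP.+-assoc (g 0) (Σℤ i (g ∘ suc)) (g (suc (suc i))))

  Σℤ-+ : ∀ i (g h : ℕ → ℤ) → Σℤ i (λ s → g s + h s) ≡ Σℤ i g + Σℤ i h
  Σℤ-+ zero g h = refl
  Σℤ-+ (suc i) g h = trans (cong (_+ (g (suc i) + h (suc i))) (Σℤ-+ i g h))
                            (interchange (Σℤ i g) (Σℤ i h) _ _)
    where
    interchange : ∀ a b c d → (a + b) + (c + d) ≡ (a + c) + (b + d)
    interchange a b c d = begin
      (a + b) + (c + d) ≡⟨ ℤP.+-assoc a b (c + d) ⟩
      a + (b + (c + d)) ≡⟨ cong (a +_) (trans (sym (ℤP.+-assoc b c d))
                             (trans (cong (_+ d) (ℤP.+-comm b c)) (ℤP.+-assoc c b d))) ⟩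
      a + (c + (b + d)) ≡⟨ sym (ℤP.+-assoc a c (b + d)) ⟩
      (a + c) + (b + d) ∎
      where open ≡-Reasoning

  Σℤ-* : ∀ i a (g : ℕ → ℤ) → a * Σℤ i g ≡ Σℤ i (λ s → a * g s)
  Σℤ-* zero a g = refl
  Σℤ-* (suc i) a g = trans (ℤP.*-distribˡ-+ a (Σℤ i g) (g (suc i))) (cong (_+ a * g (suc i)) (Σℤ-* i a g))

  Σℤ-0 : ∀ i {g : ℕ → ℤ} → (∀ s → s ≤ i → g s ≡ 0ℤ) → Σℤ i g ≡ 0ℤ
  Σℤ-0 zero e = e zero z≤n
  Σℤ-0 (suc i) e = cong₂ _+_ (Σℤ-0 i (λ s s≤ → e s (ℕP.m≤n⇒m≤1+n s≤))) (e (suc i) ℕP.≤-refl)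

  Σℤ-rev : ∀ i (g : ℕ → ℤ) → Σℤ i g ≡ Σℤ i (λ s → g (i ∸ s))
  Σℤ-rev zero g = refl
  Σℤ-rev (suc i) g = begin
    Σℤ i g + g (suc i)                    ≡⟨ ℤP.+-comm (Σℤ i g) (g (suc i)) ⟩
    g (suc i) + Σℤ i g                    ≡⟨ cong (g (suc i) +_) (Σℤ-rev i g) ⟩
    g (suc i) + Σℤ i (λ s → g (i ∸ s))    ≡⟨ sym (Σℤ-peel i (λ s → g (suc i ∸ s))) ⟩
    Σℤ (suc i) (λ s → g (suc i ∸ s)) ∎
    where open ≡-Reasoning

  Σℤ-extend : ∀ N M {g : ℕ → ℤ} → N ≤ M → (∀ s → N < s → s ≤ M → g s ≡ 0ℤ) → Σℤ M g ≡ Σℤ N g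
  Σℤ-extend N zero z≤n e = refl
  Σℤ-extend N (suc M) le e with N ℕP.≟ suc M
  ... | yes refl = refl
  ... | no ne = trans (cong₂ _+_ (Σℤ-extend N M (ℕP.≤-pred (ℕP.≤∧≢⇒< le ne)) (λ s a b → e s a (ℕP.m≤n⇒m≤1+n b)))
                                 (e (suc M) (ℕP.≤∧≢⇒< le ne) ℕP.≤-refl))
                      (ℤP.+-identityʳ _)

-- Polynomials with integer coefficients, as coefficient lists (lowest degree
-- first), compared coefficientwise; they form the commutative ring PolyRing in
-- which the Krawtchouk generating functions live.
module IntegerPolynomials where

  open import Data.Nat using (ℕ; zero; suc; _∸_)
  import Data.Nat.Properties as ℕP
  open import Data.Integer using (ℤ; _+_; _*_; -_; 0ℤ; 1ℤ)
  import Data.Integer.Properties as ℤP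
  open import Data.List using (List; []; _∷_; map)
  open import Data.Product using (_,_)
  open import Relation.Binary.PropositionalEquality
  open import Algebra.Bundles using (CommutativeRing)
  import Level
  open import Defs using (Σℤ)
  open IntegerSums

  Poly : Set
  Poly = List ℤ

  coeff : ℕ → Poly → ℤ
  coeff _ [] = 0ℤ
  coeff zero (a ∷ p) = a
  coeff (suc i) (a ∷ p) = coeff i p

  infixl 6 _⊕_
  infixl 7 _⊗_
  _⊕_ : Poly → Poly → Poly
  [] ⊕ q = q
  (a ∷ p) ⊕ [] = a ∷ p
  (a ∷ p) ⊕ (b ∷ q) = (a + b) ∷ (p ⊕ q)

  sc : ℤ → Poly → Poly
  sc a = map (a *_)

  _⊗_ : Poly → Poly → Poly
  [] ⊗ q = []
  (a ∷ p) ⊗ q = sc a q ⊕ (0ℤ ∷ (p ⊗ q))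

  negP : Poly → Poly
  negP = map -_

  infix 4 _≐_
  _≐_ : Poly → Poly → Set
  p ≐ q = ∀ i → coeff i p ≡ coeff i q

  coeff-⊕ : ∀ i p q → coeff i (p ⊕ q) ≡ coeff i p + coeff i q
  coeff-⊕ i [] q = sym (ℤP.+-identityˡ _)
  coeff-⊕ i (a ∷ p) [] = sym (ℤP.+-identityʳ _)
  coeff-⊕ zero (a ∷ p) (b ∷ q) = refl
  coeff-⊕ (suc i) (a ∷ p) (b ∷ q) = coeff-⊕ i p q

  coeff-sc : ∀ i a p → coeff i (sc a p) ≡ a * coeff i p
  coeff-sc i a [] = sym (ℤP.*-zeroʳ a)
  coeff-sc zero a (b ∷ p) = refl
  coeff-sc (suc i) a (b ∷ p) = coeff-sc i a p

  coeff-neg : ∀ i p → coeff i (negP p) ≡ - coeff i p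
  coeff-neg i [] = refl
  coeff-neg zero (b ∷ p) = refl
  coeff-neg (suc i) (b ∷ p) = coeff-neg i p

  conv : ℕ → Poly → Poly → ℤ
  conv i p q = Σℤ i (λ s → coeff s p * coeff (i ∸ s) q)

  coeff-⊗ : ∀ i p q → coeff i (p ⊗ q) ≡ conv i p q
  coeff-⊗ i [] q = sym (Σℤ-0 i (λ s _ → refl))
  coeff-⊗ zero (a ∷ p) q = trans (coeff-⊕ zero (sc a q) (0ℤ ∷ (p ⊗ q)))
    (trans (ℤP.+-identityʳ _) (coeff-sc zero a q))
  coeff-⊗ (suc i) (a ∷ p) q = begin
    coeff (suc i) (sc a q ⊕ (0ℤ ∷ (p ⊗ q)))  ≡⟨ coeff-⊕ (suc i) (sc a q) _ ⟩
    coeff (suc i) (sc a q) + coeff i (p ⊗ q) ≡⟨ cong₂ _+_ (coeff-sc (suc i) a q) (coeff-⊗ i p q) ⟩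
    a * coeff (suc i) q + conv i p q         ≡⟨ sym (Σℤ-peel i _) ⟩
    conv (suc i) (a ∷ p) q ∎
    where open ≡-Reasoning

  ⊕-cong : ∀ {p p' q q'} → p ≐ p' → q ≐ q' → p ⊕ q ≐ p' ⊕ q'
  ⊕-cong {p} {p'} {q} {q'} h h' i = trans (coeff-⊕ i p q) (trans (cong₂ _+_ (h i) (h' i)) (sym (coeff-⊕ i p' q')))

  ⊕-assoc : ∀ p q r → (p ⊕ q) ⊕ r ≐ p ⊕ (q ⊕ r)
  ⊕-assoc p q r i = begin
    coeff i ((p ⊕ q) ⊕ r) ≡⟨ trans (coeff-⊕ i (p ⊕ q) r) (cong (_+ coeff i r) (coeff-⊕ i p q)) ⟩
    coeff i p + coeff i q + coeff i r ≡⟨ ℤP.+-assoc (coeff i p) (coeff i q) (coeff i r) ⟩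
    coeff i p + (coeff i q + coeff i r) ≡⟨ sym (trans (coeff-⊕ i p (q ⊕ r)) (cong (λ x → coeff i p + x) (coeff-⊕ i q r))) ⟩
    coeff i (p ⊕ (q ⊕ r)) ∎
    where open ≡-Reasoning

  ⊕-comm : ∀ p q → p ⊕ q ≐ q ⊕ p
  ⊕-comm p q i = trans (coeff-⊕ i p q) (trans (ℤP.+-comm (coeff i p) (coeff i q)) (sym (coeff-⊕ i q p)))

  ⊕-idˡ : ∀ p → [] ⊕ p ≐ p
  ⊕-idˡ p i = refl
  ⊕-idʳ : ∀ p → p ⊕ [] ≐ p
  ⊕-idʳ p i = trans (coeff-⊕ i p []) (ℤP.+-identityʳ _)

  neg-invˡ : ∀ p → negP p ⊕ p ≐ []
  neg-invˡ p i = trans (coeff-⊕ i (negP p) p) (trans (cong (_+ coeff i p) (coeff-neg i p)) (ℤP.+-inverseˡ (coeff i p)))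
  neg-invʳ : ∀ p → p ⊕ negP p ≐ []
  neg-invʳ p i = trans (coeff-⊕ i p (negP p)) (trans (cong (λ x → coeff i p + x) (coeff-neg i p)) (ℤP.+-inverseʳ (coeff i p)))

  neg-cong : ∀ {p p'} → p ≐ p' → negP p ≐ negP p'
  neg-cong {p} {p'} h i = trans (coeff-neg i p) (trans (cong -_ (h i)) (sym (coeff-neg i p')))

  ⊗-cong : ∀ {p p' q q'} → p ≐ p' → q ≐ q' → p ⊗ q ≐ p' ⊗ q'
  ⊗-cong {p} {p'} {q} {q'} h h' i = trans (coeff-⊗ i p q) (trans
     (Σℤ-cong i (λ s _ → cong₂ _*_ (h s) (h' (i ∸ s)))) (sym (coeff-⊗ i p' q')))

  -- Commutativity by reversing the convolution sum.
  ⊗-comm : ∀ p q → p ⊗ q ≐ q ⊗ p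
  ⊗-comm p q i = trans (coeff-⊗ i p q) (trans (Σℤ-rev i _) (trans
     (Σℤ-cong i (λ s s≤ → trans (ℤP.*-comm (coeff (i ∸ s) p) (coeff (i ∸ (i ∸ s)) q)) (cong (λ t → coeff t q * coeff (i ∸ s) p) (ℕP.m∸[m∸n]≡n s≤))))
     (sym (coeff-⊗ i q p))))

  ⊗-distribʳ : ∀ r p q → (p ⊕ q) ⊗ r ≐ p ⊗ r ⊕ q ⊗ r
  ⊗-distribʳ r p q i = begin
    coeff i ((p ⊕ q) ⊗ r) ≡⟨ coeff-⊗ i (p ⊕ q) r ⟩
    conv i (p ⊕ q) r ≡⟨ Σℤ-cong i (λ s _ → trans (cong (_* coeff (i ∸ s) r) (coeff-⊕ s p q)) (ℤP.*-distribʳ-+ (coeff (i ∸ s) r) (coeff s p) (coeff s q))) ⟩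
    Σℤ i (λ s → coeff s p * coeff (i ∸ s) r + coeff s q * coeff (i ∸ s) r) ≡⟨ Σℤ-+ i _ _ ⟩
    conv i p r + conv i q r ≡⟨ sym (trans (coeff-⊕ i (p ⊗ r) (q ⊗ r)) (cong₂ _+_ (coeff-⊗ i p r) (coeff-⊗ i q r))) ⟩
    coeff i (p ⊗ r ⊕ q ⊗ r) ∎
    where open ≡-Reasoning

  ⊗-distribˡ : ∀ r p q → r ⊗ (p ⊕ q) ≐ r ⊗ p ⊕ r ⊗ q
  ⊗-distribˡ r p q i = trans (⊗-comm r (p ⊕ q) i) (trans (⊗-distribʳ r p q i)
     (⊕-cong {p ⊗ r} {r ⊗ p} {q ⊗ r} {r ⊗ q} (⊗-comm p r) (⊗-comm q r) i))

  -- Associativity of ⊗ follows by induction from its interaction with sc and shifting.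
  sc-⊗ : ∀ a q r → sc a q ⊗ r ≐ sc a (q ⊗ r)
  sc-⊗ a q r i = begin
    coeff i (sc a q ⊗ r) ≡⟨ coeff-⊗ i (sc a q) r ⟩
    conv i (sc a q) r ≡⟨ Σℤ-cong i (λ s _ → trans (cong (_* coeff (i ∸ s) r) (coeff-sc s a q)) (ℤP.*-assoc a (coeff s q) (coeff (i ∸ s) r))) ⟩
    Σℤ i (λ s → a * (coeff s q * coeff (i ∸ s) r)) ≡⟨ sym (Σℤ-* i a _) ⟩
    a * conv i q r ≡⟨ sym (trans (coeff-sc i a (q ⊗ r)) (cong (a *_) (coeff-⊗ i q r))) ⟩
    coeff i (sc a (q ⊗ r)) ∎
    where open ≡-Reasoning

  shift-⊗ : ∀ p r → (0ℤ ∷ p) ⊗ r ≐ 0ℤ ∷ (p ⊗ r)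
  shift-⊗ p r i = trans (coeff-⊕ i (sc 0ℤ r) (0ℤ ∷ (p ⊗ r)))
    (trans (cong (_+ coeff i (0ℤ ∷ (p ⊗ r))) (coeff-sc i 0ℤ r)) (ℤP.+-identityˡ _))

  cons-cong : ∀ a {p p'} → p ≐ p' → (a ∷ p) ≐ (a ∷ p')
  cons-cong a h zero = refl
  cons-cong a h (suc i) = h i

  ⊗-assoc : ∀ p q r → (p ⊗ q) ⊗ r ≐ p ⊗ (q ⊗ r)
  ⊗-assoc [] q r i = refl
  ⊗-assoc (a ∷ p) q r i = trans (⊗-distribʳ r (sc a q) (0ℤ ∷ (p ⊗ q)) i)
     (⊕-cong {sc a q ⊗ r} {sc a (q ⊗ r)} {(0ℤ ∷ (p ⊗ q)) ⊗ r} {0ℤ ∷ (p ⊗ (q ⊗ r))} (sc-⊗ a q r) (λ j → trans (shift-⊗ (p ⊗ q) r j) (cons-cong 0ℤ (⊗-assoc p q r) j)) i)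

  ⊗-idˡ : ∀ p → (1ℤ ∷ []) ⊗ p ≐ p
  ⊗-idˡ p i = trans (coeff-⊕ i (sc 1ℤ p) (0ℤ ∷ [])) (trans (cong₂ _+_ (coeff-sc i 1ℤ p) (z i)) (trans (ℤP.+-identityʳ _) (ℤP.*-identityˡ _)))
    where
    z : ∀ i → coeff i (0ℤ ∷ []) ≡ 0ℤ
    z zero = refl
    z (suc i) = refl

  ⊗-idʳ : ∀ p → p ⊗ (1ℤ ∷ []) ≐ p
  ⊗-idʳ p i = trans (⊗-comm p _ i) (⊗-idˡ p i)

  record _≈P_ (p q : Poly) : Set where
    constructor mkP
    field at : ∀ i → coeff i p ≡ coeff i q
  open _≈P_ public

  infix 4 _≈P_

  PolyRing : CommutativeRing Level.zero Level.zero
  PolyRing = record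
    { Carrier = Poly ; _≈_ = _≈P_ ; _+_ = _⊕_ ; _*_ = _⊗_ ; -_ = negP ; 0# = [] ; 1# = 1ℤ ∷ []
    ; isCommutativeRing = record
      { isRing = record
        { +-isAbelianGroup = record
          { isGroup = record
            { isMonoid = record
              { isSemigroup = record
                { isMagma = record { isEquivalence = record { refl = mkP (λ i → refl) ; sym = λ h → mkP (λ i → sym (at h i)) ; trans = λ h h' → mkP (λ i → trans (at h i) (at h' i)) }
                                   ; ∙-cong = λ {p} {p'} {q} {q'} h h' → mkP (⊕-cong {p} {p'} {q} {q'} (at h) (at h')) }
                ; assoc = λ p q r → mkP (⊕-assoc p q r) }
              ; identity = (λ p → mkP (⊕-idˡ p)) , (λ p → mkP (⊕-idʳ p)) }
            ; inverse = (λ p → mkP (neg-invˡ p)) , (λ p → mkP (neg-invʳ p))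
            ; ⁻¹-cong = λ {p} {p'} h → mkP (neg-cong {p} {p'} (at h)) }
          ; comm = λ p q → mkP (⊕-comm p q) }
        ; *-cong = λ {p} {p'} {q} {q'} h h' → mkP (⊗-cong {p} {p'} {q} {q'} (at h) (at h'))
        ; *-assoc = λ p q r → mkP (⊗-assoc p q r)
        ; *-identity = (λ p → mkP (⊗-idˡ p)) , (λ p → mkP (⊗-idʳ p))
        ; distrib = (λ r p q → mkP (⊗-distribˡ r p q)) , (λ r p q → mkP (⊗-distribʳ r p q)) }
      ; *-comm = λ p q → mkP (⊗-comm p q) } }
    where open import Data.Product using (_,_)
module RingToolkit {c ℓ : Level} (S : CommutativeRing c ℓ) where

  open import Data.Nat as ℕ using (ℕ; zero; suc; z≤n; s≤s; _≤_)
  import Data.Nat.Properties as ℕP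
  open import Data.Integer as ℤ using (ℤ; +_; -[1+_])
  import Data.Integer.Properties as ℤP
  open import Relation.Binary.PropositionalEquality as P using (_≡_)
  open import Relation.Nullary using (¬_; yes; no)
  open import Data.Empty using (⊥-elim)
  open import Function using (_∘_)
  open import Data.Maybe using (Maybe; just; nothing)
  import Algebra.Solver.Ring.AlmostCommutativeRing as ACR
  import Algebra.Solver.Ring as RingSolver
  open CommutativeRing S hiding (zero)
  open WithRing S public
  open import Relation.Binary.Reasoning.Setoid setoid
  open import Algebra.Properties.Ring ring public using (-0#≈0#; -‿distribˡ-*; -‿distribʳ-*; -‿involutive; -‿+-comm)

  private
    S-ACR = ACR.fromCommutativeRing S
    module Plain = RingSolver (ACR.AlmostCommutativeRing.rawRing S-ACR) S-ACR (ACR.-raw-almostCommutative⟶ S-ACR) (λ _ _ → nothing)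
  open Plain public using (solve; _:+_; _:*_; :-_; _:=_)

  ΣR-cong : ∀ N {g g' : ℕ → Carrier} → (∀ s → s ≤ N → g s ≈ g' s) → ΣR N g ≈ ΣR N g'
  ΣR-cong zero e = e zero z≤n
  ΣR-cong (suc N) e = +-cong (ΣR-cong N (λ s s≤ → e s (ℕP.m≤n⇒m≤1+n s≤))) (e (suc N) ℕP.≤-refl)

  ΣR-peel : ∀ N (g : ℕ → Carrier) → ΣR (suc N) g ≈ g 0 + ΣR N (g ∘ suc)
  ΣR-peel zero g = refl
  ΣR-peel (suc N) g = trans (+-congʳ (ΣR-peel N g)) (+-assoc _ _ _)

  ΣR-+ : ∀ N (g h : ℕ → Carrier) → ΣR N (λ s → g s + h s) ≈ ΣR N g + ΣR N h
  ΣR-+ zero g h = refl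
  ΣR-+ (suc N) g h = trans (+-congʳ (ΣR-+ N g h))
    (solve 4 (λ a b x y → (a :+ b) :+ (x :+ y) := (a :+ x) :+ (b :+ y)) refl _ _ _ _)

  ΣR-* : ∀ N a (g : ℕ → Carrier) → a * ΣR N g ≈ ΣR N (λ s → a * g s)
  ΣR-* zero a g = refl
  ΣR-* (suc N) a g = trans (distribˡ a _ _) (+-congʳ (ΣR-* N a g))

  ΣR-*r : ∀ N (g : ℕ → Carrier) z → ΣR N (λ u → g u * z) ≈ ΣR N g * z
  ΣR-*r N g z = trans (ΣR-cong N (λ u _ → *-comm (g u) z)) (trans (sym (ΣR-* N z g)) (*-comm z (ΣR N g)))

  ΣR-0 : ∀ N {g : ℕ → Carrier} → (∀ s → s ≤ N → g s ≈ 0#) → ΣR N g ≈ 0#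
  ΣR-0 zero e = e zero z≤n
  ΣR-0 (suc N) e = trans (+-cong (ΣR-0 N (λ s s≤ → e s (ℕP.m≤n⇒m≤1+n s≤))) (e (suc N) ℕP.≤-refl)) (+-identityˡ 0#)

  ΣR-swap : ∀ M N (F : ℕ → ℕ → Carrier) → ΣR M (λ i → ΣR N (F i)) ≈ ΣR N (λ u → ΣR M (λ i → F i u))
  ΣR-swap zero N F = refl
  ΣR-swap (suc M) N F = trans (+-congʳ (ΣR-swap M N F)) (sym (ΣR-+ N (λ u → ΣR M (λ i → F i u)) (F (suc M))))

  ΣR-single : ∀ N s0 {g : ℕ → Carrier} → s0 ≤ N → (∀ s → s ≤ N → ¬ s ≡ s0 → g s ≈ 0#) → ΣR N g ≈ g s0
  ΣR-single zero .zero z≤n e = refl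
  ΣR-single (suc N) s0 {g} le e with s0 ℕP.≟ suc N
  ... | yes P.refl = trans (+-congʳ (ΣR-0 N (λ s s≤ → e s (ℕP.m≤n⇒m≤1+n s≤) (λ eq → ℕP.<⇒≢ (s≤s s≤) eq))))
                           (+-identityˡ _)
  ... | no ne = trans (+-cong (ΣR-single N s0 (ℕP.≤-pred (ℕP.≤∧≢⇒< le ne)) (λ s s≤ → e s (ℕP.m≤n⇒m≤1+n s≤)))
                              (e (suc N) ℕP.≤-refl (λ eq → ne (P.sym eq))))
                      (+-identityʳ _)

  pw : Carrier → ℕ → Carrier
  pw x zero = 1#
  pw x (suc n) = x * pw x n

  pw-cong : ∀ {x y} n → x ≈ y → pw x n ≈ pw y n
  pw-cong zero e = refl
  pw-cong (suc n) e = *-cong e (pw-cong n e)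

  pw-+ : ∀ x m n → pw x (m ℕ.+ n) ≈ pw x m * pw x n
  pw-+ x zero n = sym (*-identityˡ _)
  pw-+ x (suc m) n = trans (*-congˡ (pw-+ x m n)) (sym (*-assoc _ _ _))

  pw-* : ∀ x y n → pw (x * y) n ≈ pw x n * pw y n
  pw-* x y zero = sym (*-identityˡ _)
  pw-* x y (suc n) = trans (*-congˡ (pw-* x y n))
    (solve 4 (λ a b c d → (a :* b) :* (c :* d) := (a :* c) :* (b :* d)) refl _ _ _ _)

  fromℕ-+ : ∀ m n → fromℕ (m ℕ.+ n) ≈ fromℕ m + fromℕ n
  fromℕ-+ zero n = sym (+-identityˡ _)
  fromℕ-+ (suc m) n = trans (+-congˡ (fromℕ-+ m n)) (sym (+-assoc _ _ _))

  fromℕ-* : ∀ m n → fromℕ (m ℕ.* n) ≈ fromℕ m * fromℕ n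
  fromℕ-* zero n = sym (zeroˡ _)
  fromℕ-* (suc m) n = trans (fromℕ-+ n (m ℕ.* n)) (trans (+-congˡ (fromℕ-* m n))
    (sym (trans (distribʳ (fromℕ n) 1# (fromℕ m)) (+-congʳ (*-identityˡ _)))))

  fromℤ-neg : ∀ x → fromℤ (ℤ.- x) ≈ - fromℤ x
  fromℤ-neg (+ zero) = sym -0#≈0#
  fromℤ-neg (+ suc m) = refl
  fromℤ-neg -[1+ m ] = sym (-‿involutive _)

  fromℤ-⊖ : ∀ m n → fromℤ (m ℤ.⊖ n) ≈ fromℕ m - fromℕ n
  fromℤ-⊖ m zero = sym (trans (+-congˡ -0#≈0#) (+-identityʳ _))
  fromℤ-⊖ zero (suc n) = sym (+-identityˡ _)
  fromℤ-⊖ (suc m) (suc n) = trans (reflexive (P.cong fromℤ (ℤP.[1+m]⊖[1+n]≡m⊖n m n)))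
    (trans (fromℤ-⊖ m n) (sym (begin
      (1# + fromℕ m) + - (1# + fromℕ n) ≈⟨ +-congˡ (sym (-‿+-comm 1# (fromℕ n))) ⟩
      (1# + fromℕ m) + (- 1# + - fromℕ n) ≈⟨ solve 4 (λ o a p b → (o :+ a) :+ (p :+ b) := (o :+ p) :+ (a :+ b)) refl 1# (fromℕ m) (- 1#) (- fromℕ n) ⟩
      (1# + - 1#) + (fromℕ m + - fromℕ n) ≈⟨ trans (+-congʳ (-‿inverseʳ 1#)) (+-identityˡ _) ⟩
      fromℕ m - fromℕ n ∎)))

  fromℤ-+ : ∀ x y → fromℤ (x ℤ.+ y) ≈ fromℤ x + fromℤ y
  fromℤ-+ (+ m) (+ n) = fromℕ-+ m n
  fromℤ-+ (+ m) -[1+ n ] = fromℤ-⊖ m (suc n)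
  fromℤ-+ -[1+ m ] (+ n) = trans (fromℤ-⊖ n (suc m)) (+-comm _ _)
  fromℤ-+ -[1+ m ] -[1+ n ] = trans (-‿cong (+-congˡ (+-congˡ (fromℕ-+ m n))))
    (trans (-‿cong (solve 3 (λ o a b → o :+ (o :+ (a :+ b)) := (o :+ a) :+ (o :+ b)) refl 1# (fromℕ m) (fromℕ n)))
           (sym (-‿+-comm _ _)))

  fromℤ-+* : ∀ m n → fromℤ (+ m ℤ.* + n) ≈ fromℕ m * fromℕ n
  fromℤ-+* m n = trans (reflexive (P.cong fromℤ (P.sym (ℤP.pos-* m n)))) (fromℕ-* m n)

  fromℤ-*⁺ : ∀ m y → fromℤ (+ m ℤ.* y) ≈ fromℕ m * fromℤ y
  fromℤ-*⁺ m (+ n) = fromℤ-+* m n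
  fromℤ-*⁺ m -[1+ n ] = begin
    fromℤ (+ m ℤ.* -[1+ n ]) ≈⟨ reflexive (P.cong fromℤ (P.sym (ℤP.neg-distribʳ-* (+ m) (+ suc n)))) ⟩
    fromℤ (ℤ.- (+ m ℤ.* + suc n)) ≈⟨ fromℤ-neg (+ m ℤ.* + suc n) ⟩
    - fromℤ (+ m ℤ.* + suc n) ≈⟨ -‿cong (fromℤ-+* m (suc n)) ⟩
    - (fromℕ m * fromℕ (suc n)) ≈⟨ -‿distribʳ-* _ _ ⟩
    fromℕ m * - fromℕ (suc n) ∎
  fromℤ-* : ∀ x y → fromℤ (x ℤ.* y) ≈ fromℤ x * fromℤ y
  fromℤ-* (+ m) y = fromℤ-*⁺ m y
  fromℤ-* -[1+ m ] y = begin
    fromℤ (-[1+ m ] ℤ.* y) ≈⟨ reflexive (P.cong fromℤ (P.sym (ℤP.neg-distribˡ-* (+ suc m) y))) ⟩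
    fromℤ (ℤ.- (+ suc m ℤ.* y)) ≈⟨ fromℤ-neg (+ suc m ℤ.* y) ⟩
    - fromℤ (+ suc m ℤ.* y) ≈⟨ -‿cong (fromℤ-*⁺ (suc m) y) ⟩
    - (fromℕ (suc m) * fromℤ y) ≈⟨ -‿distribˡ-* _ _ ⟩
    - fromℕ (suc m) * fromℤ y ∎

  fromℤ-Σ : ∀ N (g : ℕ → ℤ) → fromℤ (Σℤ N g) ≈ ΣR N (λ i → fromℤ (g i))
  fromℤ-Σ zero g = refl
  fromℤ-Σ (suc N) g = trans (fromℤ-+ (Σℤ N g) (g (suc N))) (+-congʳ (fromℤ-Σ N g))

  -- The ring solver with integer constants: fromℤ is the coefficient morphism, and
  -- equal integer constants are recognised by deciding equality in ℤ.
  private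
    fromℤ-morphism : ℤ.+-*-rawRing ACR.-Raw-AlmostCommutative⟶ S-ACR
    fromℤ-morphism = record
      { ⟦_⟧ = fromℤ ; +-homo = fromℤ-+ ; *-homo = fromℤ-* ; -‿homo = fromℤ-neg
      ; 0-homo = refl ; 1-homo = +-identityʳ 1# }

    fromℤ-equal? : ∀ (a b : ℤ) → Maybe (fromℤ a ≈ fromℤ b)
    fromℤ-equal? a b with a ℤ.≟ b
    ... | yes P.refl = just refl
    ... | no _ = nothing

  module ZS = RingSolver ℤ.+-*-rawRing S-ACR fromℤ-morphism fromℤ-equal?

  torsionFree-ℤ : TorsionFree → ∀ z x → ¬ z ≡ ℤ.0ℤ → fromℤ z * x ≈ 0# → x ≈ 0#
  torsionFree-ℤ tf (+ zero) x ne e = ⊥-elim (ne P.refl)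
  torsionFree-ℤ tf (+ suc m) x ne e = tf m x e
  torsionFree-ℤ tf -[1+ m ] x ne e = tf m x (begin
    fromℕ (suc m) * x        ≈⟨ sym (-‿involutive _) ⟩
    - - (fromℕ (suc m) * x)  ≈⟨ -‿cong (-‿distribˡ-* _ _) ⟩
    - (- fromℕ (suc m) * x)  ≈⟨ -‿cong e ⟩
    - 0#                     ≈⟨ -0#≈0# ⟩
    0# ∎)

  cancel-ℤ : TorsionFree → ∀ z {x y} → ¬ z ≡ ℤ.0ℤ → fromℤ z * x ≈ fromℤ z * y → x ≈ y
  cancel-ℤ tf z {x} {y} ne e = difference-zero (torsionFree-ℤ tf z (x - y) ne (begin
    fromℤ z * (x - y)               ≈⟨ trans (distribˡ (fromℤ z) x (- y)) (+-congˡ (sym (-‿distribʳ-* (fromℤ z) y))) ⟩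
    fromℤ z * x - fromℤ z * y       ≈⟨ +-congʳ e ⟩
    fromℤ z * y - fromℤ z * y       ≈⟨ -‿inverseʳ _ ⟩
    0# ∎))
    where
    difference-zero : x - y ≈ 0# → x ≈ y
    difference-zero d = trans (ZS.solve 2 (λ a b → a ZS.:= (a ZS.:+ (ZS.:- b)) ZS.:+ b) refl x y) (trans (+-congʳ d) (+-identityˡ y))
module Rearrangements {c ℓ : Level} (S : CommutativeRing c ℓ) where

  open import Data.Integer using (+_; -1ℤ)
  open CommutativeRing S
  open RingToolkit S using (module ZS; fromℤ)
  open ZS using (solve; _:+_; _:*_; :-_; _:=_)

  one mone : Carrier
  one = fromℤ (+ 1)
  mone = fromℤ -1ℤ

  swap-front : ∀ x y z → x * (y * z) ≈ y * (x * z)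
  swap-front = solve 3 (λ x y z → x :* (y :* z) := y :* (x :* z)) refl

  interchange : ∀ a b c d → (a * b) * (c * d) ≈ (a * c) * (b * d)
  interchange = solve 4 (λ a b c d → (a :* b) :* (c :* d) := (a :* c) :* (b :* d)) refl

  bring-third-front : ∀ c x y w → c * (x * (y * w)) ≈ y * (c * (x * w))
  bring-third-front = solve 4 (λ c x y w → c :* (x :* (y :* w)) := y :* (c :* (x :* w))) refl

  bring-second-front : ∀ c x x′ w → c * ((x * x′) * w) ≈ x * (c * (x′ * w))
  bring-second-front = solve 4 (λ c x x′ w → c :* ((x :* x′) :* w) := x :* (c :* (x′ :* w))) refl

  factor-right : ∀ a y h x b → a * (y * h) + x * (b * h) ≈ (a * y + b * x) * h
  factor-right = solve 5 (λ a y h x b → a :* (y :* h) :+ x :* (b :* h) := (a :* y :+ b :* x) :* h) refl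

  rotate : ∀ a c w → a * (c * w) ≈ c * (w * a)
  rotate = solve 3 (λ a c w → a :* (c :* w) := c :* (w :* a)) refl

  -- The rearrangement behind the three-term Krawtchouk recurrence (Kgen-recurrence):
  -- with e = q-2, B = 1 - y, A = 1 + (e+1)y, Ba = B^a, Ad = A^d, B' = B^{a-1},
  -- A' = A^{d-1} (the hypotheses say a·Ba = a·B·B' and d·Ad = d·A·A').
  recurrence-rearrangement : ∀ e a d y B' Ba Ad A' →
    a * Ba ≈ a * ((one + mone * y) * B') →
    d * Ad ≈ d * ((one + (e + one) * y) * A') →
    a * (B' * ((one + (e + one) * y) * Ad)) + (e * a) * (Ba * Ad) + ((e + one) * d) * (((one + mone * y) * Ba) * A')
      ≈ ((e + one) * (a + d)) * (Ba * Ad) + - ((e + one + one) * ((a * (mone * y) * B') * Ad + Ba * (d * ((e + one) * y) * A')))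
  recurrence-rearrangement e a d y B' Ba Ad A' ha hd = begin
    _ ≈⟨ solve 8 (λ e a d y B' Ba Ad A' →
           a :* (B' :* ((κ1 :+ (e :+ κ1) :* y) :* Ad)) :+ (e :* a) :* (Ba :* Ad) :+ ((e :+ κ1) :* d) :* (((κ1 :+ κm :* y) :* Ba) :* A')
           := a :* (B' :* ((κ1 :+ (e :+ κ1) :* y) :* Ad)) :+ e :* ((a :* Ba) :* Ad) :+ ((e :+ κ1) :* d) :* (((κ1 :+ κm :* y) :* Ba) :* A')) refl e a d y B' Ba Ad A' ⟩
    a * (B' * ((one + (e + one) * y) * Ad)) + e * ((a * Ba) * Ad) + ((e + one) * d) * (((one + mone * y) * Ba) * A')
      ≈⟨ +-congʳ (+-congˡ (*-congˡ (*-congʳ ha))) ⟩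
    a * (B' * ((one + (e + one) * y) * Ad)) + e * ((a * ((one + mone * y) * B')) * Ad) + ((e + one) * d) * (((one + mone * y) * Ba) * A')
      ≈⟨ solve 8 (λ e a d y B' Ba Ad A' →
           a :* (B' :* ((κ1 :+ (e :+ κ1) :* y) :* Ad)) :+ e :* ((a :* ((κ1 :+ κm :* y) :* B')) :* Ad) :+ ((e :+ κ1) :* d) :* (((κ1 :+ κm :* y) :* Ba) :* A')
           := (e :+ κ1) :* ((a :* ((κ1 :+ κm :* y) :* B')) :* Ad) :+ (e :+ κ1) :* (Ba :* (d :* ((κ1 :+ (e :+ κ1) :* y) :* A')))
              :+ :- ((e :+ κ1 :+ κ1) :* ((a :* (κm :* y) :* B') :* Ad :+ Ba :* (d :* ((e :+ κ1) :* y) :* A')))) refl e a d y B' Ba Ad A' ⟩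
    (e + one) * ((a * ((one + mone * y) * B')) * Ad) + (e + one) * (Ba * (d * ((one + (e + one) * y) * A')))
      + - ((e + one + one) * ((a * (mone * y) * B') * Ad + Ba * (d * ((e + one) * y) * A')))
      ≈⟨ +-congʳ (+-cong (*-congˡ (*-congʳ (sym ha))) (*-congˡ (*-congˡ (sym hd)))) ⟩
    (e + one) * ((a * Ba) * Ad) + (e + one) * (Ba * (d * Ad))
      + - ((e + one + one) * ((a * (mone * y) * B') * Ad + Ba * (d * ((e + one) * y) * A')))
      ≈⟨ solve 8 (λ e a d y B' Ba Ad A' →
           (e :+ κ1) :* ((a :* Ba) :* Ad) :+ (e :+ κ1) :* (Ba :* (d :* Ad)) :+ :- ((e :+ κ1 :+ κ1) :* ((a :* (κm :* y) :* B') :* Ad :+ Ba :* (d :* ((e :+ κ1) :* y) :* A')))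
           := ((e :+ κ1) :* (a :+ d)) :* (Ba :* Ad) :+ :- ((e :+ κ1 :+ κ1) :* ((a :* (κm :* y) :* B') :* Ad :+ Ba :* (d :* ((e :+ κ1) :* y) :* A')))) refl e a d y B' Ba Ad A' ⟩
    _ ∎
    where
    open import Relation.Binary.Reasoning.Setoid setoid
    κ1 = ZS.con (+ 1)
    κm = ZS.con -1ℤ

  substitution-B : ∀ e y → one + e * y + (e + one) * (mone * y) ≈ one + mone * y
  substitution-B = solve 2 (λ e y → ZS.con (+ 1) :+ e :* y :+ (e :+ ZS.con (+ 1)) :* (ZS.con -1ℤ :* y) := ZS.con (+ 1) :+ ZS.con -1ℤ :* y) refl
  substitution-A : ∀ e y → one + e * y + - (mone * y) ≈ one + (e + one) * y
  substitution-A = solve 2 (λ e y → ZS.con (+ 1) :+ e :* y :+ :- (ZS.con -1ℤ :* y) := ZS.con (+ 1) :+ (e :+ ZS.con (+ 1)) :* y) refl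

module Krawtchouk where

  open import Data.Nat as ℕ using (ℕ; zero; suc; _∸_; s≤s; _≤_; _<_)
  import Data.Nat.Properties as ℕP
  open import Data.Nat.Combinatorics using (_C_; nCk+nC[k+1]≡[n+1]C[k+1])
  open import Data.Integer as ℤ using (ℤ; +_; 0ℤ; 1ℤ; -1ℤ)
  import Data.Integer.Properties as ℤP
  open import Data.Integer.Solver using (module +-*-Solver)
  import Data.Nat.Solver
  open import Data.Bool using (if_then_else_)
  open import Data.List using ([]; _∷_)
  open import Data.Product using (_×_; _,_)
  open import Relation.Binary.PropositionalEquality as P using (_≡_; cong; cong₂)
  open import Defs
  open IntegerSums
  open IntegerPolynomials
  open RingToolkit PolyRing public hiding (solve; _:+_; _:*_; :-_; _:=_)
  open CommutativeRing PolyRing public hiding (zero; _+_; _*_; -_)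
  private
    module PR = Rearrangements PolyRing
    module IS = +-*-Solver
    module NS = Data.Nat.Solver.+-*-Solver

  -- The polynomials used: constants, y, A = 1+(q-1)y, B = 1-y, and the generating
  -- function Kgen q t D = B^t A^D of the Krawtchouk polynomials K_·(t; t+D).
  cst : ℤ → Poly
  cst a = a ∷ []

  yP : Poly
  yP = 0ℤ ∷ 1ℤ ∷ []

  AP : ℕ → Poly
  AP q = 1ℤ ∷ + (q ∸ 1) ∷ []

  BP : Poly
  BP = 1ℤ ∷ -1ℤ ∷ []

  Kgen : ℕ → ℕ → ℕ → Poly
  Kgen q t D = pw BP t ⊗ pw (AP q) D

  coeff-lin0 : ∀ a b p → coeff 0 ((a ∷ b ∷ []) ⊗ p) ≡ a ℤ.* coeff 0 p
  coeff-lin0 a b p = P.trans (coeff-⊕ 0 (sc a p) _) (P.trans (ℤP.+-identityʳ (coeff 0 (sc a p))) (coeff-sc 0 a p))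

  coeff-lin : ∀ i a b p → coeff (suc i) ((a ∷ b ∷ []) ⊗ p) ≡ a ℤ.* coeff (suc i) p ℤ.+ b ℤ.* coeff i p
  coeff-lin i a b p = P.trans (coeff-⊕ (suc i) (sc a p) _) (cong₂ ℤ._+_ (coeff-sc (suc i) a p)
     (P.trans (coeff-⊕ i (sc b p) (0ℤ ∷ [])) (P.trans (cong₂ ℤ._+_ (coeff-sc i b p) (z i)) (ℤP.+-identityʳ (b ℤ.* coeff i p)))))
    where
    z : ∀ i → coeff i (0ℤ ∷ []) ≡ 0ℤ
    z zero = P.refl
    z (suc i) = P.refl

  coeff-powA : ∀ q D s → coeff s (pw (AP q) D) ≡ powℤ (+ (q ∸ 1)) s ℤ.* + (D C s)
  coeff-powA q zero zero = P.refl
  coeff-powA q zero (suc s) = P.sym (ℤP.*-zeroʳ (powℤ (+ (q ∸ 1)) (suc s)))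
  coeff-powA q (suc D) zero = P.trans (coeff-lin0 1ℤ (+ (q ∸ 1)) (pw (AP q) D)) (P.trans (ℤP.*-identityˡ (coeff 0 (pw (AP q) D))) (coeff-powA q D zero))
  coeff-powA q (suc D) (suc s) = begin
    coeff (suc s) (AP q ⊗ pw (AP q) D) ≡⟨ coeff-lin s 1ℤ (+ (q ∸ 1)) (pw (AP q) D) ⟩
    1ℤ ℤ.* coeff (suc s) (pw (AP q) D) ℤ.+ + c ℤ.* coeff s (pw (AP q) D)
       ≡⟨ cong₂ (λ u v → 1ℤ ℤ.* u ℤ.+ + c ℤ.* v) (coeff-powA q D (suc s)) (coeff-powA q D s) ⟩
    1ℤ ℤ.* (+ c ℤ.* X ℤ.* + (D C suc s)) ℤ.+ + c ℤ.* (X ℤ.* + (D C s))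
       ≡⟨ IS.solve 4 (λ c x a b → IS.con 1ℤ IS.:* (c IS.:* x IS.:* b) IS.:+ c IS.:* (x IS.:* a) IS.:= c IS.:* x IS.:* (a IS.:+ b)) P.refl (+ c) X (+ (D C s)) (+ (D C suc s)) ⟩
    + c ℤ.* X ℤ.* (+ (D C s) ℤ.+ + (D C suc s)) ≡⟨ cong (λ u → + c ℤ.* X ℤ.* u) (P.trans (P.sym (ℤP.pos-+ (D C s) (D C suc s))) (cong +_ (nCk+nC[k+1]≡[n+1]C[k+1] D s))) ⟩
    + c ℤ.* X ℤ.* + (suc D C suc s) ∎
    where
    open P.≡-Reasoning
    c = q ∸ 1
    X = powℤ (+ c) s

  coeff-powB : ∀ t s → coeff s (pw BP t) ≡ sgn s ℤ.* + (t C s)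
  coeff-powB zero zero = P.refl
  coeff-powB zero (suc s) = P.sym (ℤP.*-zeroʳ (sgn (suc s)))
  coeff-powB (suc t) zero = P.trans (coeff-lin0 1ℤ -1ℤ (pw BP t)) (P.trans (ℤP.*-identityˡ (coeff 0 (pw BP t))) (coeff-powB t zero))
  coeff-powB (suc t) (suc s) = begin
    coeff (suc s) (BP ⊗ pw BP t) ≡⟨ coeff-lin s 1ℤ -1ℤ (pw BP t) ⟩
    1ℤ ℤ.* coeff (suc s) (pw BP t) ℤ.+ -1ℤ ℤ.* coeff s (pw BP t)
       ≡⟨ cong₂ (λ u v → 1ℤ ℤ.* u ℤ.+ -1ℤ ℤ.* v) (coeff-powB t (suc s)) (coeff-powB t s) ⟩
    1ℤ ℤ.* (-1ℤ ℤ.* X ℤ.* + (t C suc s)) ℤ.+ -1ℤ ℤ.* (X ℤ.* + (t C s))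
       ≡⟨ IS.solve 3 (λ x a b → IS.con 1ℤ IS.:* (IS.con -1ℤ IS.:* x IS.:* b) IS.:+ IS.con -1ℤ IS.:* (x IS.:* a) IS.:= IS.con -1ℤ IS.:* x IS.:* (a IS.:+ b)) P.refl X (+ (t C s)) (+ (t C suc s)) ⟩
    -1ℤ ℤ.* X ℤ.* (+ (t C s) ℤ.+ + (t C suc s)) ≡⟨ cong (λ u → -1ℤ ℤ.* X ℤ.* u) (P.trans (P.sym (ℤP.pos-+ (t C s) (t C suc s))) (cong +_ (nCk+nC[k+1]≡[n+1]C[k+1] t s))) ⟩
    -1ℤ ℤ.* X ℤ.* + (suc t C suc s) ∎
    where
    open P.≡-Reasoning
    X = sgn s

  Kraw-link : ∀ q i t N → Kraw q i t N ≡ coeff i (Kgen q t (N ∸ t))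
  Kraw-link q i t N = P.sym (P.trans (coeff-⊗ i (pw BP t) (pw (AP q) (N ∸ t)))
    (Σℤ-cong i (λ s _ → P.trans (cong₂ ℤ._*_ (coeff-powB t s) (coeff-powA q (N ∸ t) (i ∸ s)))
      (IS.solve 4 (λ a b c d → (a IS.:* c) IS.:* (b IS.:* d) IS.:= a IS.:* b IS.:* c IS.:* d) P.refl
        (sgn s) (powℤ (+ (q ∸ 1)) (i ∸ s)) (+ (t C s)) (+ ((N ∸ t) C (i ∸ s)))))))



  open import Relation.Binary.Reasoning.Setoid setoid

  cst-cong : ∀ {a b} → a ≡ b → cst a ≈P cst b
  cst-cong P.refl = refl

  cst-⊗ : ∀ a p → cst a ⊗ p ≈P sc a p
  cst-⊗ a p = mkP λ i → P.trans (coeff-⊕ i (sc a p) (0ℤ ∷ [])) (P.trans (cong (ℤ._+_ (coeff i (sc a p))) (coeff-0∷[] i)) (ℤP.+-identityʳ _))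
    where
    coeff-0∷[] : ∀ i → coeff i (0ℤ ∷ []) ≡ 0ℤ
    coeff-0∷[] zero = P.refl
    coeff-0∷[] (suc i) = P.refl

  cst-+ : ∀ a b → cst (a ℤ.+ b) ≈P cst a ⊕ cst b
  cst-+ a b = mkP λ { zero → P.refl ; (suc i) → P.refl }

  cst-* : ∀ a b → cst (a ℤ.* b) ≈P cst a ⊗ cst b
  cst-* a b = sym (trans (cst-⊗ a (cst b)) (mkP λ { zero → P.refl ; (suc i) → P.refl }))

  cst-0 : cst 0ℤ ≈P []
  cst-0 = mkP λ { zero → P.refl ; (suc i) → P.refl }

  sc-neg : ∀ p → sc -1ℤ p ≈P negP p
  sc-neg p = mkP λ i → P.trans (coeff-sc i -1ℤ p) (P.trans (ℤP.-1*i≡-i (coeff i p)) (P.sym (coeff-neg i p)))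

  homog : ℕ → Poly → Poly → Poly → Poly
  homog N p X Y = ΣR N (λ i → cst (coeff i p) ⊗ (pw X i ⊗ pw Y (N ∸ i)))

  Deg : Poly → ℕ → Set
  Deg p N = ∀ i → N < i → coeff i p ≡ 0ℤ

  homog-cong : ∀ N p p' X Y → p ≈P p' → homog N p X Y ≈P homog N p' X Y
  homog-cong N p p' X Y e = ΣR-cong N (λ i _ → *-congʳ {pw X i ⊗ pw Y (N ∸ i)} (cst-cong (at e i)))

  homog-sc : ∀ N a p X Y → homog N (sc a p) X Y ≈P cst a ⊗ homog N p X Y
  homog-sc N a p X Y = trans (ΣR-cong N (λ i _ → trans (*-congʳ {pw X i ⊗ pw Y (N ∸ i)} (trans (cst-cong (coeff-sc i a p)) (cst-* a (coeff i p)))) (*-assoc (cst a) (cst (coeff i p)) (pw X i ⊗ pw Y (N ∸ i)))))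
    (sym (ΣR-* N (cst a) _))

  homog-⊕ : ∀ N p p' X Y → homog N (p ⊕ p') X Y ≈P homog N p X Y ⊕ homog N p' X Y
  homog-⊕ N p p' X Y = trans (ΣR-cong N (λ i _ → trans (*-congʳ {pw X i ⊗ pw Y (N ∸ i)} (trans (cst-cong (coeff-⊕ i p p')) (cst-+ (coeff i p) (coeff i p')))) (distribʳ (pw X i ⊗ pw Y (N ∸ i)) (cst (coeff i p)) (cst (coeff i p')))))
    (ΣR-+ N _ _)

  homog-up : ∀ N p X Y → Deg p N → homog (suc N) p X Y ≈P Y ⊗ homog N p X Y
  homog-up N p X Y dg = begin
    homog (suc N) p X Y ≈⟨ +-cong (ΣR-cong N (λ i i≤ → term i i≤)) (trans (*-congʳ {pw X (suc N) ⊗ pw Y (suc N ∸ suc N)} (trans (cst-cong (dg (suc N) ℕP.≤-refl)) cst-0)) (zeroˡ (pw X (suc N) ⊗ pw Y (suc N ∸ suc N)))) ⟩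
    ΣR N (λ i → Y ⊗ (cst (coeff i p) ⊗ (pw X i ⊗ pw Y (N ∸ i)))) ⊕ [] ≈⟨ +-identityʳ _ ⟩
    ΣR N (λ i → Y ⊗ (cst (coeff i p) ⊗ (pw X i ⊗ pw Y (N ∸ i)))) ≈⟨ sym (ΣR-* N Y _) ⟩
    Y ⊗ homog N p X Y ∎
    where
    term : ∀ i → i ≤ N → cst (coeff i p) ⊗ (pw X i ⊗ pw Y (suc N ∸ i)) ≈P Y ⊗ (cst (coeff i p) ⊗ (pw X i ⊗ pw Y (N ∸ i)))
    term i i≤ rewrite ℕP.+-∸-assoc 1 i≤ = PR.bring-third-front (cst (coeff i p)) (pw X i) Y (pw Y (N ∸ i))

  homog-shift : ∀ N p X Y → homog (suc N) (0ℤ ∷ p) X Y ≈P X ⊗ homog N p X Y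
  homog-shift N p X Y = begin
    homog (suc N) (0ℤ ∷ p) X Y ≈⟨ ΣR-peel N _ ⟩
    cst 0ℤ ⊗ (1# ⊗ pw Y (suc N)) ⊕ ΣR N (λ i → cst (coeff i p) ⊗ ((X ⊗ pw X i) ⊗ pw Y (N ∸ i))) ≈⟨ +-cong (trans (*-congʳ {1# ⊗ pw Y (suc N)} cst-0) (zeroˡ (1# ⊗ pw Y (suc N)))) (ΣR-cong N (λ i _ →
         PR.bring-second-front (cst (coeff i p)) X (pw X i) (pw Y (N ∸ i)))) ⟩
    [] ⊕ ΣR N (λ i → X ⊗ (cst (coeff i p) ⊗ (pw X i ⊗ pw Y (N ∸ i)))) ≈⟨ +-identityˡ _ ⟩
    ΣR N (λ i → X ⊗ (cst (coeff i p) ⊗ (pw X i ⊗ pw Y (N ∸ i)))) ≈⟨ sym (ΣR-* N X _) ⟩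
    X ⊗ homog N p X Y ∎

  lin-split : ∀ a b p → (a ∷ b ∷ []) ⊗ p ≈P sc a p ⊕ (0ℤ ∷ sc b p)
  lin-split a b p = mkP λ
    { zero → P.trans (coeff-lin0 a b p) (P.trans (P.sym (coeff-sc 0 a p)) (P.sym (P.trans (coeff-⊕ 0 (sc a p) (0ℤ ∷ sc b p)) (ℤP.+-identityʳ _))))
    ; (suc i) → P.trans (coeff-lin i a b p) (P.sym (P.trans (coeff-⊕ (suc i) (sc a p) (0ℤ ∷ sc b p)) (cong₂ ℤ._+_ (coeff-sc (suc i) a p) (coeff-sc i b p)))) }

  homog-linear : ∀ N a b p X Y → Deg p N → homog (suc N) ((a ∷ b ∷ []) ⊗ p) X Y ≈P (cst a ⊗ Y ⊕ cst b ⊗ X) ⊗ homog N p X Y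
  homog-linear N a b p X Y dg = begin
    homog (suc N) ((a ∷ b ∷ []) ⊗ p) X Y ≈⟨ homog-cong (suc N) _ _ X Y (lin-split a b p) ⟩
    homog (suc N) (sc a p ⊕ (0ℤ ∷ sc b p)) X Y ≈⟨ homog-⊕ (suc N) (sc a p) _ X Y ⟩
    homog (suc N) (sc a p) X Y ⊕ homog (suc N) (0ℤ ∷ sc b p) X Y ≈⟨ +-cong (trans (homog-sc (suc N) a p X Y) (*-congˡ {cst a} (homog-up N p X Y dg))) (trans (homog-shift N (sc b p) X Y) (*-congˡ {X} (homog-sc N b p X Y))) ⟩
    cst a ⊗ (Y ⊗ homog N p X Y) ⊕ X ⊗ (cst b ⊗ homog N p X Y) ≈⟨ PR.factor-right (cst a) Y (homog N p X Y) X (cst b) ⟩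
    (cst a ⊗ Y ⊕ cst b ⊗ X) ⊗ homog N p X Y ∎

  Deg-lin : ∀ N a b p → Deg p N → Deg ((a ∷ b ∷ []) ⊗ p) (suc N)
  Deg-lin N a b p dg (suc i) (s≤s N<i) = P.trans (coeff-lin i a b p)
    (P.trans (cong₂ (λ u v → a ℤ.* u ℤ.+ b ℤ.* v) (dg (suc i) (ℕP.m≤n⇒m≤1+n N<i)) (dg i N<i)) (P.cong₂ ℤ._+_ (ℤP.*-zeroʳ a) (ℤP.*-zeroʳ b)))

  Deg-cong : ∀ p p' N → p ≈P p' → Deg p N → Deg p' N
  Deg-cong p p' N e dg i lt = P.trans (P.sym (at e i)) (dg i lt)

  Kgen-sucD : ∀ q t D → Kgen q t (suc D) ≈P AP q ⊗ Kgen q t D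
  Kgen-sucD q t D = PR.swap-front (pw BP t) (AP q) (pw (AP q) D)

  Kgen-suct : ∀ q t → Kgen q (suc t) 0 ≈P BP ⊗ Kgen q t 0
  Kgen-suct q t = *-assoc BP (pw BP t) 1#

  Deg-Kgen : ∀ q t D → Deg (Kgen q t D) (t ℕ.+ D)
  Deg-Kgen q zero zero (suc i) _ = P.refl
  Deg-Kgen q (suc t) zero = Deg-cong _ (Kgen q (suc t) 0) (suc (t ℕ.+ 0)) (sym (Kgen-suct q t)) (Deg-lin (t ℕ.+ 0) 1ℤ -1ℤ (Kgen q t 0) (Deg-Kgen q t zero))
  Deg-Kgen q t (suc D) rewrite ℕP.+-suc t D = Deg-cong _ (Kgen q t (suc D)) (suc (t ℕ.+ D)) (sym (Kgen-sucD q t D)) (Deg-lin (t ℕ.+ D) 1ℤ (+ (q ∸ 1)) (Kgen q t D) (Deg-Kgen q t D))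

  homog-Kgen : ∀ q t D X Y → homog (t ℕ.+ D) (Kgen q t D) X Y ≈P pw (Y ⊕ cst (+ (q ∸ 1)) ⊗ X) D ⊗ pw (Y ⊕ negP X) t
  homog-Kgen q zero zero X Y = mkP λ { zero → P.refl ; (suc i) → P.refl }
  homog-Kgen q (suc t) zero X Y = begin
    homog (suc (t ℕ.+ 0)) (Kgen q (suc t) 0) X Y ≈⟨ homog-cong (suc (t ℕ.+ 0)) _ _ X Y (Kgen-suct q t) ⟩
    homog (suc (t ℕ.+ 0)) (BP ⊗ Kgen q t 0) X Y ≈⟨ homog-linear (t ℕ.+ 0) 1ℤ -1ℤ (Kgen q t 0) X Y (Deg-Kgen q t 0) ⟩
    (cst 1ℤ ⊗ Y ⊕ cst -1ℤ ⊗ X) ⊗ homog (t ℕ.+ 0) (Kgen q t 0) X Y ≈⟨ *-cong (+-cong (*-identityˡ Y) (trans (cst-⊗ -1ℤ X) (sc-neg X))) (homog-Kgen q t zero X Y) ⟩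
    (Y ⊕ negP X) ⊗ (1# ⊗ pw (Y ⊕ negP X) t) ≈⟨ PR.swap-front (Y ⊕ negP X) 1# _ ⟩
    1# ⊗ pw (Y ⊕ negP X) (suc t) ∎
  homog-Kgen q t (suc D) X Y rewrite ℕP.+-suc t D = begin
    homog (suc (t ℕ.+ D)) (Kgen q t (suc D)) X Y ≈⟨ homog-cong (suc (t ℕ.+ D)) _ _ X Y (Kgen-sucD q t D) ⟩
    homog (suc (t ℕ.+ D)) (AP q ⊗ Kgen q t D) X Y ≈⟨ homog-linear (t ℕ.+ D) 1ℤ (+ (q ∸ 1)) (Kgen q t D) X Y (Deg-Kgen q t D) ⟩
    (cst 1ℤ ⊗ Y ⊕ cst (+ (q ∸ 1)) ⊗ X) ⊗ homog (t ℕ.+ D) (Kgen q t D) X Y ≈⟨ *-cong (+-congʳ (*-identityˡ Y)) (homog-Kgen q t D X Y) ⟩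
    (Y ⊕ cst (+ (q ∸ 1)) ⊗ X) ⊗ (pw (Y ⊕ cst (+ (q ∸ 1)) ⊗ X) D ⊗ pw (Y ⊕ negP X) t) ≈⟨ sym (*-assoc (Y ⊕ cst (+ (q ∸ 1)) ⊗ X) (pw (Y ⊕ cst (+ (q ∸ 1)) ⊗ X) D) (pw (Y ⊕ negP X) t)) ⟩
    pw (Y ⊕ cst (+ (q ∸ 1)) ⊗ X) (suc D) ⊗ pw (Y ⊕ negP X) t ∎

  coeff-ΣR : ∀ i N (F : ℕ → Poly) → coeff i (ΣR N F) ≡ Σℤ N (λ u → coeff i (F u))
  coeff-ΣR i zero F = P.refl
  coeff-ΣR i (suc N) F = P.trans (coeff-⊕ i (ΣR N F) (F (suc N))) (cong (ℤ._+ coeff i (F (suc N))) (coeff-ΣR i N F))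

  coeff-cst⊗ : ∀ i a p → coeff i (cst a ⊗ p) ≡ a ℤ.* coeff i p
  coeff-cst⊗ i a p = P.trans (at (cst-⊗ a p) i) (coeff-sc i a p)

  -- The Euler operator y·d/dy, which multiplies the i-th coefficient by i.
  eulerFrom : ℕ → Poly → Poly
  eulerFrom k [] = []
  eulerFrom k (a ∷ p) = (+ k ℤ.* a) ∷ eulerFrom (suc k) p

  coeff-eulerFrom : ∀ i k p → coeff i (eulerFrom k p) ≡ + (k ℕ.+ i) ℤ.* coeff i p
  coeff-eulerFrom i k [] = P.sym (ℤP.*-zeroʳ (+ (k ℕ.+ i)))
  coeff-eulerFrom zero k (a ∷ p) = cong (λ z → + z ℤ.* a) (P.sym (ℕP.+-identityʳ k))
  coeff-eulerFrom (suc i) k (a ∷ p) = P.trans (coeff-eulerFrom i (suc k) p) (cong (λ z → + z ℤ.* coeff i p) (P.sym (ℕP.+-suc k i)))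

  euler : Poly → Poly
  euler = eulerFrom 0

  coeff-euler : ∀ i p → coeff i (euler p) ≡ + i ℤ.* coeff i p
  coeff-euler i p = coeff-eulerFrom i 0 p

  euler-1 : euler 1# ≈P []
  euler-1 = mkP λ { zero → P.refl ; (suc i) → P.refl }

  euler-Leibniz′ : ∀ p q i → coeff i (euler (p ⊗ q)) ≡ coeff i (euler p ⊗ q ⊕ p ⊗ euler q)
  euler-Leibniz′ p q i =
    P.trans (P.trans (coeff-euler i (p ⊗ q)) (cong (+ i ℤ.*_) (coeff-⊗ i p q)))
    (P.trans (Σℤ-* i (+ i) _)
    (P.trans (Σℤ-cong i (λ s s≤ → lem s s≤))
    (P.trans (Σℤ-+ i _ _)
    (P.sym (P.trans (coeff-⊕ i (euler p ⊗ q) (p ⊗ euler q)) (cong₂ ℤ._+_ (coeff-⊗ i (euler p) q) (coeff-⊗ i p (euler q))))))))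
    where
    lem : ∀ s → s ≤ i → + i ℤ.* (coeff s p ℤ.* coeff (i ∸ s) q) ≡ coeff s (euler p) ℤ.* coeff (i ∸ s) q ℤ.+ coeff s p ℤ.* coeff (i ∸ s) (euler q)
    lem s s≤ rewrite coeff-euler s p | coeff-euler (i ∸ s) q = P.trans (cong (λ z → z ℤ.* (coeff s p ℤ.* coeff (i ∸ s) q))
          (P.trans (cong +_ (P.sym (ℕP.m+[n∸m]≡n s≤))) (ℤP.pos-+ s (i ∸ s))))
       (IS.solve 4 (λ a b x y → (a IS.:+ b) IS.:* (x IS.:* y) IS.:= a IS.:* x IS.:* y IS.:+ x IS.:* (b IS.:* y)) P.refl (+ s) (+ (i ∸ s)) (coeff s p) (coeff (i ∸ s) q))

  euler-Leibniz : ∀ p q → euler (p ⊗ q) ≈P euler p ⊗ q ⊕ p ⊗ euler q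
  euler-Leibniz p q = mkP (euler-Leibniz′ p q)

  cst0⊗ : ∀ p → cst 0ℤ ⊗ p ≈P []
  cst0⊗ p = trans (*-congʳ {p} cst-0) (zeroˡ p)

  euler-pow : ∀ p n → euler (pw p n) ≈P cst (+ n) ⊗ euler p ⊗ pw p (n ∸ 1)
  euler-pow p zero = trans euler-1 (sym (trans (*-assoc (cst 0ℤ) (euler p) 1#) (cst0⊗ (euler p ⊗ 1#))))
  euler-pow p (suc zero) = begin
    euler (p ⊗ 1#) ≈⟨ euler-Leibniz p 1# ⟩
    euler p ⊗ 1# ⊕ p ⊗ euler 1# ≈⟨ +-congˡ {euler p ⊗ 1#} (trans (*-congˡ {p} euler-1) (zeroʳ p)) ⟩
    euler p ⊗ 1# ⊕ [] ≈⟨ +-identityʳ (euler p ⊗ 1#) ⟩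
    euler p ⊗ 1# ≈⟨ *-congʳ {1#} (sym (*-identityˡ (euler p))) ⟩
    cst (+ 1) ⊗ euler p ⊗ 1# ∎
  euler-pow p (suc (suc n)) = begin
    euler (p ⊗ pw p (suc n)) ≈⟨ euler-Leibniz p (pw p (suc n)) ⟩
    euler p ⊗ pw p (suc n) ⊕ p ⊗ euler (pw p (suc n)) ≈⟨ +-congˡ {euler p ⊗ pw p (suc n)} (*-congˡ {p} (euler-pow p (suc n))) ⟩
    euler p ⊗ (p ⊗ pw p n) ⊕ p ⊗ ((cst (+ suc n) ⊗ euler p) ⊗ pw p n) ≈⟨ +-congˡ {euler p ⊗ (p ⊗ pw p n)} (PR.swap-front p (cst (+ suc n) ⊗ euler p) (pw p n)) ⟩
    euler p ⊗ (p ⊗ pw p n) ⊕ (cst (+ suc n) ⊗ euler p) ⊗ (p ⊗ pw p n) ≈⟨ +-congʳ {(cst (+ suc n) ⊗ euler p) ⊗ (p ⊗ pw p n)} (*-congʳ {p ⊗ pw p n} (sym (*-identityˡ (euler p)))) ⟩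
    (1# ⊗ euler p) ⊗ (p ⊗ pw p n) ⊕ (cst (+ suc n) ⊗ euler p) ⊗ (p ⊗ pw p n) ≈⟨ sym (distribʳ (p ⊗ pw p n) (1# ⊗ euler p) (cst (+ suc n) ⊗ euler p)) ⟩
    (1# ⊗ euler p ⊕ cst (+ suc n) ⊗ euler p) ⊗ (p ⊗ pw p n) ≈⟨ *-congʳ {p ⊗ pw p n} (sym (distribʳ (euler p) 1# (cst (+ suc n)))) ⟩
    ((1# ⊕ cst (+ suc n)) ⊗ euler p) ⊗ (p ⊗ pw p n) ≈⟨ *-congʳ {p ⊗ pw p n} (*-congʳ {euler p} (sym (cst-+ (+ 1) (+ suc n)))) ⟩
    cst (+ suc (suc n)) ⊗ euler p ⊗ pw p (suc n) ∎

  κ : ℤ → Poly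
  κ = fromℤ

  cst-pos-* : ∀ m n → cst (+ (m ℕ.* n)) ≈P cst (+ m) ⊗ cst (+ n)
  cst-pos-* m n = trans (cst-cong (ℤP.pos-* m n)) (cst-* (+ m) (+ n))

  q-1≡ : ∀ q → 2 ≤ q → + (q ∸ 1) ≡ + (q ∸ 2) ℤ.+ + 1
  q-1≡ zero ()
  q-1≡ (suc zero) (s≤s ())
  q-1≡ (suc (suc q)) _ = P.trans (cong +_ (ℕP.+-comm 1 q)) (ℤP.pos-+ q 1)

  q≡ : ∀ q → 2 ≤ q → + q ≡ + (q ∸ 2) ℤ.+ + 1 ℤ.+ + 1
  q≡ zero ()
  q≡ (suc zero) (s≤s ())
  q≡ (suc (suc q)) _ = P.trans (cong +_ (P.trans (ℕP.+-comm 2 q) (P.sym (ℕP.+-assoc q 1 1)))) (P.trans (ℤP.pos-+ (q ℕ.+ 1) 1) (cong (ℤ._+ + 1) (ℤP.pos-+ q 1)))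

  c≈e+1 : ∀ q → 2 ≤ q → cst (+ (q ∸ 1)) ≈P cst (+ (q ∸ 2)) ⊕ κ (+ 1)
  c≈e+1 q le = trans (cst-cong (q-1≡ q le)) (cst-+ (+ (q ∸ 2)) (+ 1))

  q≈e+2 : ∀ q → 2 ≤ q → cst (+ q) ≈P cst (+ (q ∸ 2)) ⊕ κ (+ 1) ⊕ κ (+ 1)
  q≈e+2 q le = trans (cst-cong (q≡ q le)) (trans (cst-+ (+ (q ∸ 2) ℤ.+ + 1) (+ 1)) (+-congʳ {κ (+ 1)} (cst-+ (+ (q ∸ 2)) (+ 1))))

  B≈1-y : BP ≈P κ (+ 1) ⊕ κ -1ℤ ⊗ yP
  B≈1-y = mkP λ { zero → P.refl ; (suc zero) → P.refl ; (suc (suc i)) → P.refl }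

  A≈1+cy : ∀ q → AP q ≈P κ (+ 1) ⊕ cst (+ (q ∸ 1)) ⊗ yP
  A≈1+cy q = mkP λ { zero → P.sym (cong (λ z → + 1 ℤ.+ (z ℤ.+ 0ℤ)) (ℤP.*-zeroʳ (+ (q ∸ 1)))) ; (suc zero) → P.sym (P.trans (coeff-⊕ 1 (κ (+ 1)) (cst (+ (q ∸ 1)) ⊗ yP)) (P.trans (cong (λ z → 0ℤ ℤ.+ z) (coeff-cst⊗ 1 (+ (q ∸ 1)) yP)) (P.trans (ℤP.+-identityˡ (+ (q ∸ 1) ℤ.* 1ℤ)) (ℤP.*-identityʳ (+ (q ∸ 1)))))) ; (suc (suc i)) → P.refl }

  euler-B : euler BP ≈P κ -1ℤ ⊗ yP
  euler-B = mkP λ { zero → P.refl ; (suc zero) → P.refl ; (suc (suc i)) → P.refl }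

  euler-A : ∀ q → euler (AP q) ≈P cst (+ (q ∸ 1)) ⊗ yP
  euler-A q = mkP λ i → P.trans (coeff-euler i (AP q)) (P.trans (lem i) (P.sym (coeff-cst⊗ i (+ (q ∸ 1)) yP)))
    where
    lem : ∀ i → + i ℤ.* coeff i (AP q) ≡ + (q ∸ 1) ℤ.* coeff i yP
    lem zero = P.sym (ℤP.*-zeroʳ (+ (q ∸ 1)))
    lem (suc zero) = P.trans (ℤP.*-identityˡ (+ (q ∸ 1))) (P.sym (ℤP.*-identityʳ (+ (q ∸ 1))))
    lem (suc (suc i)) = P.trans (ℤP.*-zeroʳ (+ suc (suc i))) (P.sym (ℤP.*-zeroʳ (+ (q ∸ 1))))

  suc-diff : ∀ a d → suc (a ℕ.+ d) ∸ a ≡ suc d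
  suc-diff a d = P.trans (cong (_∸ a) (P.sym (ℕP.+-suc a d))) (ℕP.m+n∸m≡n a (suc d))

  -- Pulling one factor out of a power when the power is multiplied by its
  -- exponent (so the case of exponent 0 is trivial).
  lower-t : ∀ q a d → cst (+ a) ⊗ Kgen q (a ∸ 1) (a ℕ.+ d ∸ (a ∸ 1)) ≈P cst (+ a) ⊗ (pw BP (a ∸ 1) ⊗ (AP q ⊗ pw (AP q) d))
  lower-t q zero d = trans (cst0⊗ (Kgen q 0 d)) (sym (cst0⊗ (pw BP 0 ⊗ (AP q ⊗ pw (AP q) d))))
  lower-t q (suc a) d rewrite suc-diff a d = refl

  raise-t : ∀ q a d → cst (+ ((q ∸ 1) ℕ.* d)) ⊗ Kgen q (suc a) (a ℕ.+ d ∸ suc a) ≈P cst (+ ((q ∸ 1) ℕ.* d)) ⊗ ((BP ⊗ pw BP a) ⊗ pw (AP q) (d ∸ 1))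
  raise-t q a zero rewrite ℕP.*-zeroʳ (q ∸ 1) = trans (cst0⊗ (Kgen q (suc a) (a ℕ.+ 0 ∸ suc a))) (sym (cst0⊗ ((BP ⊗ pw BP a) ⊗ pw (AP q) 0)))
  raise-t q a (suc d) rewrite ℕP.+-suc a d | ℕP.m+n∸m≡n a d = refl

  peel-B : ∀ a → cst (+ a) ⊗ pw BP a ≈P cst (+ a) ⊗ (BP ⊗ pw BP (a ∸ 1))
  peel-B zero = trans (cst0⊗ (pw BP 0)) (sym (cst0⊗ (BP ⊗ pw BP 0)))
  peel-B (suc a) = refl

  peel-A : ∀ q d → cst (+ d) ⊗ pw (AP q) d ≈P cst (+ d) ⊗ (AP q ⊗ pw (AP q) (d ∸ 1))
  peel-A q zero = trans (cst0⊗ (pw (AP q) 0)) (sym (cst0⊗ (AP q ⊗ pw (AP q) 0)))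
  peel-A q (suc d) = refl

  Kgen-recurrence : ∀ q a d → 2 ≤ q →
    cst (+ a) ⊗ Kgen q (a ∸ 1) (a ℕ.+ d ∸ (a ∸ 1)) ⊕ cst (+ ((q ∸ 2) ℕ.* a)) ⊗ Kgen q a d ⊕ cst (+ ((q ∸ 1) ℕ.* d)) ⊗ Kgen q (suc a) (a ℕ.+ d ∸ suc a)
    ≈P cst (+ ((q ∸ 1) ℕ.* (a ℕ.+ d))) ⊗ Kgen q a d ⊕ negP (cst (+ q) ⊗ euler (Kgen q a d))
  Kgen-recurrence q a d le = begin
    _ ≈⟨ +-cong (+-cong lower-term middle-term) raise-term ⟩
    _ ≈⟨ PR.recurrence-rearrangement e ac dc yP B' Ba Ad A' peeled-B peeled-A ⟩
    _ ≈⟨ +-cong scalar-part (-‿cong euler-part) ⟩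
    _ ∎
    where
    e = cst (+ (q ∸ 2))
    ac = cst (+ a)
    dc = cst (+ d)
    B' = pw BP (a ∸ 1)
    Ba = pw BP a
    Ad = pw (AP q) d
    A' = pw (AP q) (d ∸ 1)
    o = κ (+ 1)
    m1 = κ -1ℤ
    Bexpr = o ⊕ m1 ⊗ yP
    Aexpr = o ⊕ (e ⊕ o) ⊗ yP
    Aeq : AP q ≈P Aexpr
    Aeq = trans (A≈1+cy q) (+-congˡ {o} (*-congʳ {yP} (c≈e+1 q le)))
    lower-term : cst (+ a) ⊗ Kgen q (a ∸ 1) (a ℕ.+ d ∸ (a ∸ 1)) ≈P ac ⊗ (B' ⊗ (Aexpr ⊗ Ad))
    lower-term = trans (lower-t q a d) (*-congˡ {ac} (*-congˡ {B'} (*-congʳ {Ad} Aeq)))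
    middle-term : cst (+ ((q ∸ 2) ℕ.* a)) ⊗ (Ba ⊗ Ad) ≈P (e ⊗ ac) ⊗ (Ba ⊗ Ad)
    middle-term = *-congʳ {Ba ⊗ Ad} (cst-pos-* (q ∸ 2) a)
    raise-term : cst (+ ((q ∸ 1) ℕ.* d)) ⊗ Kgen q (suc a) (a ℕ.+ d ∸ suc a) ≈P ((e ⊕ o) ⊗ dc) ⊗ ((Bexpr ⊗ Ba) ⊗ A')
    raise-term = trans (raise-t q a d) (*-cong (trans (cst-pos-* (q ∸ 1) d) (*-congʳ {dc} (c≈e+1 q le))) (*-congʳ {A'} (*-congʳ {Ba} B≈1-y)))
    peeled-B : ac ⊗ Ba ≈P ac ⊗ (Bexpr ⊗ B')
    peeled-B = trans (peel-B a) (*-congˡ {ac} (*-congʳ {B'} B≈1-y))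
    peeled-A : dc ⊗ Ad ≈P dc ⊗ (Aexpr ⊗ A')
    peeled-A = trans (peel-A q d) (*-congˡ {dc} (*-congʳ {A'} Aeq))
    scalar-part : ((e ⊕ o) ⊗ (ac ⊕ dc)) ⊗ (Ba ⊗ Ad) ≈P cst (+ ((q ∸ 1) ℕ.* (a ℕ.+ d))) ⊗ Kgen q a d
    scalar-part = *-congʳ {Ba ⊗ Ad} (sym (trans (cst-pos-* (q ∸ 1) (a ℕ.+ d)) (*-cong (c≈e+1 q le) (trans (cst-cong (ℤP.pos-+ a d)) (cst-+ (+ a) (+ d))))))
    euler-product : euler (Ba ⊗ Ad) ≈P (ac ⊗ (m1 ⊗ yP) ⊗ B') ⊗ Ad ⊕ Ba ⊗ (dc ⊗ ((e ⊕ o) ⊗ yP) ⊗ A')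
    euler-product = trans (euler-Leibniz Ba Ad) (+-cong (*-congʳ {Ad} (trans (euler-pow BP a) (*-congʳ {B'} (*-congˡ {ac} euler-B))))
                                       (*-congˡ {Ba} (trans (euler-pow (AP q) d) (*-congʳ {A'} (*-congˡ {dc} (trans (euler-A q) (*-congʳ {yP} (c≈e+1 q le))))))))
    euler-part : (e ⊕ o ⊕ o) ⊗ ((ac ⊗ (m1 ⊗ yP) ⊗ B') ⊗ Ad ⊕ Ba ⊗ (dc ⊗ ((e ⊕ o) ⊗ yP) ⊗ A')) ≈P cst (+ q) ⊗ euler (Kgen q a d)
    euler-part = sym (*-cong (q≈e+2 q le) euler-product)

  -- The eigenvalue (q-1)k - qu of the Hamming graph H(k,q) on its u-th eigenspace.
  eigval : ℕ → ℕ → ℕ → ℤ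
  eigval q k u = + ((q ∸ 1) ℕ.* k) ℤ.- + (q ℕ.* u)

  Kraw-recurrence′ : ∀ q a d u → 2 ≤ q →
    + a ℤ.* Kraw q u (a ∸ 1) (a ℕ.+ d) ℤ.+ + ((q ∸ 2) ℕ.* a) ℤ.* Kraw q u a (a ℕ.+ d) ℤ.+ + ((q ∸ 1) ℕ.* d) ℤ.* Kraw q u (suc a) (a ℕ.+ d)
    ≡ eigval q (a ℕ.+ d) u ℤ.* Kraw q u a (a ℕ.+ d)
  Kraw-recurrence′ q a d u le = P.trans lhs (P.trans (at (Kgen-recurrence q a d le) u) rhs)
    where
    -- Both sides are u-th coefficients of the two sides of Kgen-recurrence.
    P0 = coeff u (Kgen q a d)
    L1 = cst (+ a) ⊗ Kgen q (a ∸ 1) (a ℕ.+ d ∸ (a ∸ 1))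
    L2 = cst (+ ((q ∸ 2) ℕ.* a)) ⊗ Kgen q a d
    L3 = cst (+ ((q ∸ 1) ℕ.* d)) ⊗ Kgen q (suc a) (a ℕ.+ d ∸ suc a)
    e1 : Kraw q u a (a ℕ.+ d) ≡ P0
    e1 = P.trans (Kraw-link q u a (a ℕ.+ d)) (cong (λ z → coeff u (Kgen q a z)) (ℕP.m+n∸m≡n a d))
    lhs : _ ≡ coeff u (cst (+ a) ⊗ Kgen q (a ∸ 1) (a ℕ.+ d ∸ (a ∸ 1)) ⊕ cst (+ ((q ∸ 2) ℕ.* a)) ⊗ Kgen q a d ⊕ cst (+ ((q ∸ 1) ℕ.* d)) ⊗ Kgen q (suc a) (a ℕ.+ d ∸ suc a))
    lhs = P.sym (P.trans (coeff-⊕ u (L1 ⊕ L2) L3) (cong₂ ℤ._+_ (P.trans (coeff-⊕ u L1 L2) (cong₂ ℤ._+_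
            (P.trans (coeff-cst⊗ u (+ a) (Kgen q (a ∸ 1) (a ℕ.+ d ∸ (a ∸ 1)))) (cong (+ a ℤ.*_) (P.sym (Kraw-link q u (a ∸ 1) (a ℕ.+ d)))))
            (P.trans (coeff-cst⊗ u (+ ((q ∸ 2) ℕ.* a)) (Kgen q a d)) (cong (+ ((q ∸ 2) ℕ.* a) ℤ.*_) (P.sym e1)))))
            (P.trans (coeff-cst⊗ u (+ ((q ∸ 1) ℕ.* d)) (Kgen q (suc a) (a ℕ.+ d ∸ suc a))) (cong (+ ((q ∸ 1) ℕ.* d) ℤ.*_) (P.sym (Kraw-link q u (suc a) (a ℕ.+ d)))))))
    rhs : coeff u (cst (+ ((q ∸ 1) ℕ.* (a ℕ.+ d))) ⊗ Kgen q a d ⊕ negP (cst (+ q) ⊗ euler (Kgen q a d))) ≡ eigval q (a ℕ.+ d) u ℤ.* Kraw q u a (a ℕ.+ d)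
    rhs = P.trans (coeff-⊕ u (cst (+ ((q ∸ 1) ℕ.* (a ℕ.+ d))) ⊗ Kgen q a d) (negP (cst (+ q) ⊗ euler (Kgen q a d)))) (P.trans (cong₂ ℤ._+_ (coeff-cst⊗ u (+ ((q ∸ 1) ℕ.* (a ℕ.+ d))) (Kgen q a d))
            (P.trans (coeff-neg u (cst (+ q) ⊗ euler (Kgen q a d))) (cong ℤ.-_ (P.trans (coeff-cst⊗ u (+ q) (euler (Kgen q a d))) (cong (+ q ℤ.*_) (coeff-euler u (Kgen q a d)))))))
            (P.trans (IS.solve 4 (λ x Q U p → x IS.:* p IS.:+ IS.:- (Q IS.:* (U IS.:* p)) IS.:= (x IS.:- Q IS.:* U) IS.:* p) P.refl
                        (+ ((q ∸ 1) ℕ.* (a ℕ.+ d))) (+ q) (+ u) P0)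
                     (cong₂ ℤ._*_ (cong (λ z → + ((q ∸ 1) ℕ.* (a ℕ.+ d)) ℤ.- z) (P.sym (ℤP.pos-* q u))) (P.sym e1))))

  Kraw-recurrence : ∀ q k a u → 2 ≤ q → a ≤ k →
    + a ℤ.* Kraw q u (a ∸ 1) k ℤ.+ + ((q ∸ 2) ℕ.* a) ℤ.* Kraw q u a k ℤ.+ + ((q ∸ 1) ℕ.* (k ∸ a)) ℤ.* Kraw q u (suc a) k
    ≡ eigval q k u ℤ.* Kraw q u a k
  Kraw-recurrence q k a u le a≤k = P.subst (λ K → + a ℤ.* Kraw q u (a ∸ 1) K ℤ.+ + ((q ∸ 2) ℕ.* a) ℤ.* Kraw q u a K ℤ.+ + ((q ∸ 1) ℕ.* (k ∸ a)) ℤ.* Kraw q u (suc a) K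
    ≡ eigval q K u ℤ.* Kraw q u a K) (ℕP.m+[n∸m]≡n a≤k) (Kraw-recurrence′ q a (k ∸ a) u le)

  δℤ : ℕ → ℕ → ℤ
  δℤ x y = if x ℕ.≡ᵇ y then 1ℤ else 0ℤ

  coeff-ypow : ∀ i n → coeff i (pw yP n) ≡ δℤ i n
  coeff-ypow zero zero = P.refl
  coeff-ypow (suc i) zero = P.refl
  coeff-ypow zero (suc n) = coeff-lin0 0ℤ 1ℤ (pw yP n)
  coeff-ypow (suc i) (suc n) = P.trans (coeff-lin i 0ℤ 1ℤ (pw yP n)) (P.trans (ℤP.+-identityˡ (1ℤ ℤ.* coeff i (pw yP n))) (P.trans (ℤP.*-identityˡ (coeff i (pw yP n))) (coeff-ypow i n)))

  pw-cst : ∀ a n → pw (cst a) n ≈P cst (powℤ a n)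
  pw-cst a zero = refl
  pw-cst a (suc n) = trans (*-congˡ {cst a} (pw-cst a n)) (sym (cst-* a (powℤ a n)))

  coeff-homog : ∀ i N p X Y → coeff i (homog N p X Y) ≡ Σℤ N (λ u → coeff u p ℤ.* coeff i (pw X u ⊗ pw Y (N ∸ u)))
  coeff-homog i N p X Y = P.trans (coeff-ΣR i N _) (Σℤ-cong N (λ u _ → coeff-cst⊗ i (coeff u p) (pw X u ⊗ pw Y (N ∸ u))))

  homog-Kraw : ∀ q t N X Y → t ≤ N → homog N (Kgen q t (N ∸ t)) X Y ≈P pw (Y ⊕ cst (+ (q ∸ 1)) ⊗ X) (N ∸ t) ⊗ pw (Y ⊕ negP X) t
  homog-Kraw q t N X Y le = P.subst (λ M → homog M (Kgen q t (N ∸ t)) X Y ≈P pw (Y ⊕ cst (+ (q ∸ 1)) ⊗ X) (N ∸ t) ⊗ pw (Y ⊕ negP X) t)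
     (ℕP.m+[n∸m]≡n le) (homog-Kgen q t (N ∸ t) X Y)

  -- The substitution X = B, Y = A turns the two linear factors into q and q·y.
  A+cB≈q : ∀ q → 1 ≤ q → AP q ⊕ cst (+ (q ∸ 1)) ⊗ BP ≈P cst (+ q)
  A+cB≈q (suc q) _ = mkP λ { zero → P.trans (cong (ℤ._+_ 1ℤ) (P.trans (ℤP.+-identityʳ (+ q ℤ.* 1ℤ)) (ℤP.*-identityʳ (+ q)))) (P.sym (ℤP.pos-+ 1 q))
                          ; (suc zero) → P.trans (cong (ℤ._+_ (+ q)) (P.trans (coeff-cst⊗ 1 (+ q) BP) (ℤP.*-comm (+ q) -1ℤ))) (P.trans (cong (ℤ._+_ (+ q)) (ℤP.-1*i≡-i (+ q))) (ℤP.+-inverseʳ (+ q)))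
                          ; (suc (suc i)) → P.trans (coeff-cst⊗ (suc (suc i)) (+ q) BP) (ℤP.*-zeroʳ (+ q)) }

  A-B≈qy : ∀ q → 1 ≤ q → AP q ⊕ negP BP ≈P cst (+ q) ⊗ yP
  A-B≈qy (suc q) _ = mkP λ { zero → P.trans (ℤP.+-inverseʳ 1ℤ) (P.sym (P.trans (coeff-cst⊗ 0 (+ suc q) yP) (ℤP.*-zeroʳ (+ suc q))))
                          ; (suc zero) → P.trans (P.trans (ℤP.+-comm (+ q) 1ℤ) (P.sym (ℤP.pos-+ 1 q))) (P.sym (P.trans (coeff-cst⊗ 1 (+ suc q) yP) (ℤP.*-identityʳ (+ suc q))))
                          ; (suc (suc i)) → P.sym (P.trans (coeff-cst⊗ (suc (suc i)) (+ suc q) yP) (ℤP.*-zeroʳ (+ suc q))) }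

  Kraw-orthogonality : ∀ q k a0 a → 1 ≤ q → a ≤ k → Σℤ k (λ u → Kraw q a0 u k ℤ.* Kraw q u a k) ≡ powℤ (+ q) k ℤ.* δℤ a0 a
  Kraw-orthogonality q k a0 a q≥1 a≤k = P.trans lhs (P.trans (at generating-product a0) rhs)
    where
    -- Homogenising the generating function of K_·(a;k) at X = B, Y = A gives the
    -- generating function of u ↦ K_u(a;k) paired with K_{a₀}(u;k), and it equals q^k y^a.
    Qc = cst (+ q)
    generating-product : homog k (Kgen q a (k ∸ a)) BP (AP q) ≈P cst (powℤ (+ q) ((k ∸ a) ℕ.+ a)) ⊗ pw yP a
    generating-product = begin
      homog k (Kgen q a (k ∸ a)) BP (AP q) ≈⟨ homog-Kraw q a k BP (AP q) a≤k ⟩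
      pw (AP q ⊕ cst (+ (q ∸ 1)) ⊗ BP) (k ∸ a) ⊗ pw (AP q ⊕ negP BP) a ≈⟨ *-cong (pw-cong (k ∸ a) (A+cB≈q q q≥1)) (pw-cong a (A-B≈qy q q≥1)) ⟩
      pw Qc (k ∸ a) ⊗ pw (Qc ⊗ yP) a ≈⟨ *-congˡ {pw Qc (k ∸ a)} (pw-* Qc yP a) ⟩
      pw Qc (k ∸ a) ⊗ (pw Qc a ⊗ pw yP a) ≈⟨ sym (*-assoc (pw Qc (k ∸ a)) (pw Qc a) (pw yP a)) ⟩
      (pw Qc (k ∸ a) ⊗ pw Qc a) ⊗ pw yP a ≈⟨ *-congʳ {pw yP a} (sym (pw-+ Qc (k ∸ a) a)) ⟩
      pw Qc ((k ∸ a) ℕ.+ a) ⊗ pw yP a ≈⟨ *-congʳ {pw yP a} (pw-cst (+ q) ((k ∸ a) ℕ.+ a)) ⟩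
      cst (powℤ (+ q) ((k ∸ a) ℕ.+ a)) ⊗ pw yP a ∎
    lhs : Σℤ k (λ u → Kraw q a0 u k ℤ.* Kraw q u a k) ≡ coeff a0 (homog k (Kgen q a (k ∸ a)) BP (AP q))
    lhs = P.sym (P.trans (coeff-homog a0 k (Kgen q a (k ∸ a)) BP (AP q))
            (Σℤ-cong k (λ u _ → P.trans (cong₂ ℤ._*_ (P.sym (Kraw-link q u a k)) (P.sym (Kraw-link q a0 u k))) (ℤP.*-comm (Kraw q u a k) (Kraw q a0 u k)))))
    rhs : coeff a0 (cst (powℤ (+ q) ((k ∸ a) ℕ.+ a)) ⊗ pw yP a) ≡ powℤ (+ q) k ℤ.* δℤ a0 a
    rhs = P.trans (coeff-cst⊗ a0 (powℤ (+ q) ((k ∸ a) ℕ.+ a)) (pw yP a)) (cong₂ ℤ._*_ (cong (powℤ (+ q)) (ℕP.m∸n+n≡m a≤k)) (coeff-ypow a0 a))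

  Kraw-vanish : ∀ q i t N → t ≤ N → N < i → Kraw q i t N ≡ 0ℤ
  Kraw-vanish q i t N le lt = P.trans (Kraw-link q i t N) (Deg-Kgen q t (N ∸ t) i (P.subst (_< i) (P.sym (ℕP.m+[n∸m]≡n le)) lt))

  yP⊗0 : ∀ W → coeff 0 (yP ⊗ W) ≡ 0ℤ
  yP⊗0 W = coeff-lin0 0ℤ 1ℤ W

  yP⊗s : ∀ m W → coeff (suc m) (yP ⊗ W) ≡ coeff m W
  yP⊗s m W = P.trans (coeff-lin m 0ℤ 1ℤ W) (P.trans (ℤP.+-identityˡ (1ℤ ℤ.* coeff m W)) (ℤP.*-identityˡ (coeff m W)))

  yshift : ∀ i m W → coeff (i ℕ.+ m) (pw yP i ⊗ W) ≡ coeff m W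
  yshift zero m W = at (*-identityˡ W) m
  yshift (suc i) m W = P.trans (at (*-assoc yP (pw yP i) W) (suc i ℕ.+ m)) (P.trans (yP⊗s (i ℕ.+ m) (pw yP i ⊗ W)) (yshift i m W))

  yzero : ∀ i m W → m < i → coeff m (pw yP i ⊗ W) ≡ 0ℤ
  yzero (suc i) zero W _ = P.trans (at (*-assoc yP (pw yP i) W) 0) (yP⊗0 (pw yP i ⊗ W))
  yzero (suc i) (suc m) W (s≤s lt) = P.trans (at (*-assoc yP (pw yP i) W) (suc m)) (P.trans (yP⊗s m (pw yP i ⊗ W)) (yzero i m W lt))


  ∸-from-+ : ∀ A B C → A ≡ B ℕ.+ C → A ∸ B ≡ C
  ∸-from-+ A B C e = P.trans (cong (_∸ B) e) (ℕP.m+n∸m≡n B C)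

  -- Exponent bookkeeping for the reduction identity; writing k = u+x, h = k+y and
  -- n = h+(k+z) turns every truncated subtraction into an addition.
  exponent-identities : ∀ n h k u → u ≤ k → k ≤ h → h ≤ n → k ≤ n ∸ h →
    ((k ∸ u) ℕ.+ (h ∸ k) ≡ h ∸ u) × (u ℕ.+ (n ∸ 2 ℕ.* k ∸ (h ∸ k)) ≡ (n ∸ k) ∸ (h ∸ u))
  exponent-identities n h k u u≤k k≤h h≤n k≤n∸h
    with x , P.refl ← ℕP.m≤n⇒∃[o]m+o≡n u≤k
    with y , P.refl ← ℕP.m≤n⇒∃[o]m+o≡n k≤h
    with w , P.refl ← ℕP.m≤n⇒∃[o]m+o≡n h≤n
    with z , P.refl ← ℕP.m≤n⇒∃[o]m+o≡n (P.subst (k ≤_) (ℕP.m+n∸m≡n h w) k≤n∸h)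
    = P.trans (cong₂ ℕ._+_ k∸u h∸k) (P.sym h∸u)
    , P.trans (cong (u ℕ.+_) (P.trans (cong₂ _∸_ n∸2k h∸k) (ℕP.m+n∸m≡n y z)))
              (P.sym (P.trans (cong₂ _∸_ n∸k h∸u) (ℕP.m+n∸m≡n (x ℕ.+ y) (u ℕ.+ z))))
    where
    k∸u : k ∸ u ≡ x
    k∸u = ℕP.m+n∸m≡n u x
    h∸k : h ∸ k ≡ y
    h∸k = ℕP.m+n∸m≡n k y
    h∸u : h ∸ u ≡ x ℕ.+ y
    h∸u = ∸-from-+ h u (x ℕ.+ y) (ℕP.+-assoc u x y)
    n∸2k : n ∸ 2 ℕ.* k ≡ y ℕ.+ z
    n∸2k = ∸-from-+ n (2 ℕ.* k) (y ℕ.+ z)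
      (NS.solve 4 (λ u x y z → (u NS.:+ x NS.:+ y) NS.:+ ((u NS.:+ x) NS.:+ z) NS.:= (NS.con 2 NS.:* (u NS.:+ x)) NS.:+ (y NS.:+ z)) P.refl u x y z)
    n∸k : n ∸ k ≡ (x ℕ.+ y) ℕ.+ (u ℕ.+ z)
    n∸k = ∸-from-+ n k ((x ℕ.+ y) ℕ.+ (u ℕ.+ z))
      (NS.solve 4 (λ u x y z → (u NS.:+ x NS.:+ y) NS.:+ ((u NS.:+ x) NS.:+ z) NS.:= (u NS.:+ x) NS.:+ ((x NS.:+ y) NS.:+ (u NS.:+ z))) P.refl u x y z)

-- Substituting X = -y, Y = 1+(q-2)y in the homogenised generating function of
-- K_·(u;k) gives  (1-y)^{k-u} (1+(q-1)y)^u;  multiplied by the generating function of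
-- K_·(h-k; n-2k) this is the generating function of K_·(h-u; n-k), while
-- coefficientwise it produces exactly the coefficients r_{ij}.
module Reduction (q n h k u j : ℕ) (q≥2 : 2 ≤ q) (u≤k : u ≤ k) (k≤h : k ≤ h) (h≤n : h ≤ n) (k≤n∸h : k ≤ n ∸ h) where

  open import Data.Nat as ℕ using (ℕ; _∸_; _≤_; _<_)
  import Data.Nat.Properties as ℕP
  open import Data.Nat.Combinatorics using (_C_)
  open import Data.Integer as ℤ using (ℤ; +_; 0ℤ; -1ℤ)
  import Data.Integer.Properties as ℤP
  open import Data.Integer.Solver using (module +-*-Solver)
  open import Data.Product using (proj₁; proj₂)
  open import Relation.Binary.PropositionalEquality as P using (_≡_; cong; cong₂)
  open import Defs
  open IntegerSums
  open IntegerPolynomials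
  open Krawtchouk
  private
    module PR = Rearrangements PolyRing
    module IS = +-*-Solver

  Xp Yp K′ : Poly
  Xp = cst -1ℤ ⊗ yP
  Yp = AP (q ∸ 1)
  K′ = Kgen q (h ∸ k) (n ∸ 2 ℕ.* k ∸ (h ∸ k))

  Yp≈1+ey : Yp ≈P κ (+ 1) ⊕ cst (+ (q ∸ 2)) ⊗ yP
  Yp≈1+ey = trans (A≈1+cy (q ∸ 1)) (+-congˡ {κ (+ 1)} (*-congʳ {yP} (cst-cong (cong +_ (ℕP.∸-+-assoc q 1 1)))))

  substituted-B : Yp ⊕ cst (+ (q ∸ 1)) ⊗ Xp ≈P BP
  substituted-B = trans (+-cong Yp≈1+ey (*-congʳ {Xp} (c≈e+1 q q≥2))) (trans (PR.substitution-B (cst (+ (q ∸ 2))) yP) (sym B≈1-y))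

  substituted-A : Yp ⊕ negP Xp ≈P AP q
  substituted-A = trans (+-congʳ {negP Xp} Yp≈1+ey)
    (trans (PR.substitution-A (cst (+ (q ∸ 2))) yP) (sym (trans (A≈1+cy q) (+-congˡ {κ (+ 1)} (*-congʳ {yP} (c≈e+1 q q≥2))))))

  product-of-generators : homog k (Kgen q u (k ∸ u)) Xp Yp ⊗ K′ ≈P Kgen q (h ∸ u) ((n ∸ k) ∸ (h ∸ u))
  product-of-generators = begin
    homog k (Kgen q u (k ∸ u)) Xp Yp ⊗ K′
      ≈⟨ *-congʳ {K′} (homog-Kraw q u k Xp Yp u≤k) ⟩
    (pw (Yp ⊕ cst (+ (q ∸ 1)) ⊗ Xp) (k ∸ u) ⊗ pw (Yp ⊕ negP Xp) u) ⊗ K′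
      ≈⟨ *-congʳ {K′} (*-cong (pw-cong (k ∸ u) substituted-B) (pw-cong u substituted-A)) ⟩
    (pw BP (k ∸ u) ⊗ pw (AP q) u) ⊗ (pw BP (h ∸ k) ⊗ pw (AP q) D′)
      ≈⟨ PR.interchange (pw BP (k ∸ u)) (pw (AP q) u) (pw BP (h ∸ k)) (pw (AP q) D′) ⟩
    (pw BP (k ∸ u) ⊗ pw BP (h ∸ k)) ⊗ (pw (AP q) u ⊗ pw (AP q) D′)
      ≈⟨ sym (*-cong (pw-+ BP (k ∸ u) (h ∸ k)) (pw-+ (AP q) u D′)) ⟩
    pw BP ((k ∸ u) ℕ.+ (h ∸ k)) ⊗ pw (AP q) (u ℕ.+ D′)
      ≈⟨ reflexive (cong₂ (λ a b → pw BP a ⊗ pw (AP q) b) (proj₁ exponents) (proj₂ exponents)) ⟩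
    Kgen q (h ∸ u) ((n ∸ k) ∸ (h ∸ u)) ∎
    where
    open import Relation.Binary.Reasoning.Setoid setoid
    D′ = n ∸ 2 ℕ.* k ∸ (h ∸ k)
    exponents = exponent-identities n h k u u≤k k≤h h≤n k≤n∸h

  term : ℕ → ℤ
  term i = coeff j ((pw Xp i ⊗ pw Yp (k ∸ i)) ⊗ K′)

  term-sign : ∀ i → term i ≡ sgn i ℤ.* coeff j (pw yP i ⊗ (pw Yp (k ∸ i) ⊗ K′))
  term-sign i = P.trans (at (trans (*-assoc (pw Xp i) (pw Yp (k ∸ i)) K′) (trans (*-congʳ {pw Yp (k ∸ i) ⊗ K′} Xp^i)
                   (*-assoc (cst (sgn i)) (pw yP i) (pw Yp (k ∸ i) ⊗ K′)))) j)
                 (coeff-cst⊗ j (sgn i) (pw yP i ⊗ (pw Yp (k ∸ i) ⊗ K′)))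
    where
    Xp^i : pw Xp i ≈P cst (sgn i) ⊗ pw yP i
    Xp^i = trans (pw-* (cst -1ℤ) yP i) (*-congʳ {pw yP i} (pw-cst -1ℤ i))

  term-vanishes : ∀ i → j < i → term i ≡ 0ℤ
  term-vanishes i lt = P.trans (term-sign i) (P.trans (cong (sgn i ℤ.*_) (yzero i j (pw Yp (k ∸ i) ⊗ K′) lt)) (ℤP.*-zeroʳ (sgn i)))

  term≡r : ∀ i → i ≤ j → term i ≡ r q n h k i j
  term≡r i le = P.trans (term-sign i) (cong (sgn i ℤ.*_) (P.trans
      (P.subst (λ J → coeff J (pw yP i ⊗ (pw Yp (k ∸ i) ⊗ K′)) ≡ coeff (j ∸ i) (pw Yp (k ∸ i) ⊗ K′)) (ℕP.m+[n∸m]≡n le) (yshift i (j ∸ i) (pw Yp (k ∸ i) ⊗ K′)))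
      (P.trans (coeff-⊗ (j ∸ i) (pw Yp (k ∸ i)) K′) (Σℤ-cong (j ∸ i) (λ l _ →
         P.trans (cong₂ ℤ._*_ (coeff-powA (q ∸ 1) (k ∸ i) l) (P.sym (Kraw-link q (j ∸ i ∸ l) (h ∸ k) (n ∸ 2 ℕ.* k))))
           (P.trans (cong (λ z → powℤ (+ z) l ℤ.* + ((k ∸ i) C l) ℤ.* Kraw q (j ∸ i ∸ l) (h ∸ k) (n ∸ 2 ℕ.* k)) (ℕP.∸-+-assoc q 1 1))
             (IS.solve 3 (λ a b c → a IS.:* b IS.:* c IS.:= c IS.:* a IS.:* b) P.refl (powℤ (+ (q ∸ 2)) l) (+ ((k ∸ i) C l)) (Kraw q (j ∸ i ∸ l) (h ∸ k) (n ∸ 2 ℕ.* k)))))))))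

  coeff-product : coeff j (homog k (Kgen q u (k ∸ u)) Xp Yp ⊗ K′) ≡ Σℤ k (λ i → Kraw q i u k ℤ.* term i)
  coeff-product = P.trans (at (trans (*-comm (ΣR k summand) K′) (ΣR-* k K′ summand)) j)
    (P.trans (coeff-ΣR j k (λ i → K′ ⊗ summand i)) (Σℤ-cong k (λ i _ →
      P.trans (at (PR.rotate K′ (cst (coeff i (Kgen q u (k ∸ u)))) (pw Xp i ⊗ pw Yp (k ∸ i))) j)
        (P.trans (coeff-cst⊗ j (coeff i (Kgen q u (k ∸ u))) ((pw Xp i ⊗ pw Yp (k ∸ i)) ⊗ K′))
          (cong (ℤ._* term i) (P.sym (Kraw-link q i u k)))))))
    where
    summand : ℕ → Poly
    summand i = cst (coeff i (Kgen q u (k ∸ u))) ⊗ (pw Xp i ⊗ pw Yp (k ∸ i))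

  reduction-identity : Σℤ j (λ i → r q n h k i j ℤ.* Kraw q i u k) ≡ Kraw q j (h ∸ u) (n ∸ k)
  reduction-identity = begin
    Σℤ j (λ i → r q n h k i j ℤ.* Kraw q i u k)
      ≡⟨ Σℤ-cong j (λ i le → P.trans (ℤP.*-comm (r q n h k i j) (Kraw q i u k)) (cong (Kraw q i u k ℤ.*_) (P.sym (term≡r i le)))) ⟩
    Σℤ j (λ i → Kraw q i u k ℤ.* term i)
      ≡⟨ Σℤ-extend j (k ℕ.+ j) (ℕP.m≤n+m j k) (λ i lt _ → P.trans (cong (Kraw q i u k ℤ.*_) (term-vanishes i lt)) (ℤP.*-zeroʳ (Kraw q i u k))) ⟨
    Σℤ (k ℕ.+ j) (λ i → Kraw q i u k ℤ.* term i)
      ≡⟨ Σℤ-extend k (k ℕ.+ j) (ℕP.m≤m+n k j) (λ i lt _ → P.trans (cong (ℤ._* term i) (Kraw-vanish q i u k u≤k lt)) (ℤP.*-zeroˡ (term i))) ⟩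
    Σℤ k (λ i → Kraw q i u k ℤ.* term i)
      ≡⟨ coeff-product ⟨
    coeff j (homog k (Kgen q u (k ∸ u)) Xp Yp ⊗ K′)
      ≡⟨ at product-of-generators j ⟩
    coeff j (Kgen q (h ∸ u) ((n ∸ k) ∸ (h ∸ u)))
      ≡⟨ Kraw-link q j (h ∸ u) (n ∸ k) ⟨
    Kraw q j (h ∸ u) (n ∸ k) ∎
    where open P.≡-Reasoning

module HammingDistance where

  open import Data.Nat as ℕ using (ℕ; zero; suc; z≤n; s≤s; _≤_)
  import Data.Nat.Properties as ℕP
  open import Data.Fin as F using (Fin; zero; suc)
  open import Data.Fin.Subset using (Subset; ∁; ∣_∣)
  open import Data.Bool using (Bool; true; false; not; _∧_; _∨_; if_then_else_)
  import Data.Bool.Properties as BoolP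
  open import Data.Bool.ListAction using (and)
  open import Data.List using (map; tabulate; filter; length)
  open import Data.Vec using ([]; _∷_; lookup)
  open import Relation.Binary.PropositionalEquality as P using (_≡_; cong; cong₂)
  open import Relation.Nullary using (yes; no; ¬_; does)
  open import Data.Empty using (⊥-elim)
  open import Function using (_∘_)
  open import Defs

  ==-suc : ∀ {q} (x y : Fin q) → (suc x == suc y) ≡ (x == y)
  ==-suc x y with x F.≟ y
  ... | yes _ = P.refl
  ... | no _ = P.refl

  ==-refl : ∀ {q} (x : Fin q) → (x == x) ≡ true
  ==-refl zero = P.refl
  ==-refl (suc x) = P.trans (==-suc x x) (==-refl x)

  ==-false : ∀ {q} (x y : Fin q) → ¬ x ≡ y → (x == y) ≡ false
  ==-false x y ne with x F.≟ y
  ... | yes p = ⊥-elim (ne p)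
  ... | no _ = P.refl

  ==-sym : ∀ {q} (x y : Fin q) → (x == y) ≡ (y == x)
  ==-sym x y with x F.≟ y | y F.≟ x
  ... | yes _ | yes _ = P.refl
  ... | no _ | no _ = P.refl
  ... | yes p | no np = ⊥-elim (np (P.sym p))
  ... | no np | yes p = ⊥-elim (np (P.sym p))

  mismatch : Bool → ℕ
  mismatch true = 0
  mismatch false = 1

  dist : ∀ {q n} → Vtx q n → Vtx q n → ℕ
  dist {n = zero} α β = 0
  dist {n = suc n} α β = mismatch (α zero == β zero) ℕ.+ dist (α ∘ suc) (β ∘ suc)

  distOn : ∀ {q n} → Subset n → Vtx q n → Vtx q n → ℕ
  distOn [] α β = 0
  distOn (true ∷ I) α β = mismatch (α zero == β zero) ℕ.+ distOn I (α ∘ suc) (β ∘ suc)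
  distOn (false ∷ I) α β = distOn I (α ∘ suc) (β ∘ suc)

  does≟true : ∀ b → does (b BoolP.≟ true) ≡ b
  does≟true true = P.refl
  does≟true false = P.refl

  countT : ∀ m → (Fin m → Bool) → ℕ
  countT zero g = 0
  countT (suc m) g = (if g zero then 1 else 0) ℕ.+ countT m (g ∘ suc)

  length-filter-tabulate : ∀ {N} m (h : Fin m → Fin N) (g : Fin N → Bool) → length (filter (λ i → g i BoolP.≟ true) (tabulate h)) ≡ countT m (λ i → g (h i))
  length-filter-tabulate zero h g = P.refl
  length-filter-tabulate (suc m) h g with g (h zero)
  ... | true = cong suc (length-filter-tabulate m (h ∘ suc) g)
  ... | false = length-filter-tabulate m (h ∘ suc) g

  countT-dist : ∀ {q} n (α β : Vtx q n) → countT n (λ i → not (α i == β i)) ≡ dist α β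
  countT-dist zero α β = P.refl
  countT-dist (suc n) α β = cong₂ ℕ._+_ (lem (α zero == β zero)) (countT-dist n (α ∘ suc) (β ∘ suc))
    where
    lem : ∀ b → (if not b then 1 else 0) ≡ mismatch b
    lem true = P.refl
    lem false = P.refl

  ρ≡dist : ∀ {q n} (α β : Vtx q n) → ρ α β ≡ dist α β
  ρ≡dist {n = n} α β = P.trans (length-filter-tabulate n (λ i → i) (λ i → not (α i == β i))) (countT-dist n α β)

  allT : ∀ m → (Fin m → Bool) → Bool
  allT zero g = true
  allT (suc m) g = g zero ∧ allT m (g ∘ suc)

  and-map-tabulate : ∀ {A : Set} m (h : Fin m → A) (g : A → Bool) → and (map g (tabulate h)) ≡ allT m (λ i → g (h i))
  and-map-tabulate zero h g = P.refl
  and-map-tabulate (suc m) h g = cong (g (h zero) ∧_) (and-map-tabulate m (h ∘ suc) g)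

  inFace≡allT : ∀ {q n} (J : Subset n) (α β : Vtx q n) → inFace J α β ≡ allT n (λ i → lookup J i ∨ (β i == α i))
  inFace≡allT {n = n} J α β = and-map-tabulate n (λ i → i) (λ i → lookup J i ∨ (β i == α i))

  inFace-∁ : ∀ {q n} (I : Subset n) (α β : Vtx q n) → allT n (λ i → lookup (∁ I) i ∨ (β i == α i)) ≡ (distOn I α β ℕ.≡ᵇ 0)
  inFace-∁ [] α β = P.refl
  inFace-∁ (true ∷ I) α β rewrite ==-sym (β zero) (α zero) with α zero == β zero
  ... | true = inFace-∁ I (α ∘ suc) (β ∘ suc)
  ... | false = P.refl
  inFace-∁ (false ∷ I) α β = inFace-∁ I (α ∘ suc) (β ∘ suc)

  inFace-self : ∀ {q n} (I : Subset n) (α β : Vtx q n) → allT n (λ i → lookup I i ∨ (β i == α i)) ≡ (distOn (∁ I) α β ℕ.≡ᵇ 0)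
  inFace-self [] α β = P.refl
  inFace-self (false ∷ I) α β rewrite ==-sym (β zero) (α zero) with α zero == β zero
  ... | true = inFace-self I (α ∘ suc) (β ∘ suc)
  ... | false = P.refl
  inFace-self (true ∷ I) α β = inFace-self I (α ∘ suc) (β ∘ suc)

  dist-split : ∀ {q n} (I : Subset n) (α β : Vtx q n) → dist α β ≡ distOn I α β ℕ.+ distOn (∁ I) α β
  dist-split [] α β = P.refl
  dist-split (true ∷ I) α β = P.trans (cong (mismatch (α zero == β zero) ℕ.+_) (dist-split I (α ∘ suc) (β ∘ suc))) (P.sym (ℕP.+-assoc (mismatch (α zero == β zero)) _ _))
  dist-split (false ∷ I) α β = P.trans (cong (d ℕ.+_) (dist-split I (α ∘ suc) (β ∘ suc)))
    (P.trans (P.sym (ℕP.+-assoc d a b)) (P.trans (cong (ℕ._+ b) (ℕP.+-comm d a)) (ℕP.+-assoc a d b)))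
    where
    d = mismatch (α zero == β zero)
    a = distOn I (α ∘ suc) (β ∘ suc)
    b = distOn (∁ I) (α ∘ suc) (β ∘ suc)

  mismatch≤1 : ∀ b → mismatch b ≤ 1
  mismatch≤1 true = z≤n
  mismatch≤1 false = s≤s z≤n

  distOn≤ : ∀ {q n} (I : Subset n) (α β : Vtx q n) → distOn I α β ≤ ∣ I ∣
  distOn≤ [] α β = z≤n
  distOn≤ (true ∷ I) α β = ℕP.+-mono-≤ (mismatch≤1 (α zero == β zero)) (distOn≤ I (α ∘ suc) (β ∘ suc))
  distOn≤ (false ∷ I) α β = distOn≤ I (α ∘ suc) (β ∘ suc)

module HammingSums {c ℓ : Level} (R : CommutativeRing c ℓ) where

  open import Data.Nat as ℕ using (ℕ; zero; suc; _∸_; z≤n; s≤s; _≤_)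
  import Data.Nat.Properties as ℕP
  open import Data.Integer as ℤ using (ℤ)
  import Data.Integer.Properties as ℤP
  open import Data.Fin as F using (Fin; zero; suc)
  open import Data.Fin.Subset using (Subset; ∁; ∣_∣)
  open import Data.Bool using (Bool; true; false; _∧_; if_then_else_)
  import Data.Bool.Properties as BoolP
  open import Data.List using (List; []; _∷_; _++_; map; concatMap; tabulate; allFin; filter)
  open import Data.Vec using ([]; _∷_)
  open import Relation.Binary.PropositionalEquality as P using (_≡_; cong; cong₂)
  open import Relation.Nullary using (Dec; yes; no; ¬_; does)
  open import Relation.Nullary.Decidable using (⌊_⌋; isYes≗does)
  open import Data.Empty using (⊥-elim)
  open import Function using (_∘_)
  open import Defs
  open HammingDistance
  open Krawtchouk using (δℤ)
  open Rearrangements R using (swap-front)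
  open CommutativeRing R hiding (zero)
  open RingToolkit R
  open import Relation.Binary.Reasoning.Setoid setoid
  open ZS using () renaming (solve to zsolve; _:+_ to _⊞_; _:*_ to _⊠_; _:=_ to _⩦_; con to κ)

  ΣFin : ∀ m → (Fin m → Carrier) → Carrier
  ΣFin zero g = 0#
  ΣFin (suc m) g = g zero + ΣFin m (g ∘ suc)

  ΣL-tab : ∀ {A : Set} m (h : Fin m → A) (g : A → Carrier) → ΣL (tabulate h) g ≡ ΣFin m (g ∘ h)
  ΣL-tab zero h g = P.refl
  ΣL-tab (suc m) h g = cong (g (h zero) +_) (ΣL-tab m (h ∘ suc) g)

  ΣL-++ : ∀ {A : Set} (xs ys : List A) g → ΣL (xs ++ ys) g ≈ ΣL xs g + ΣL ys g
  ΣL-++ [] ys g = sym (+-identityˡ _)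
  ΣL-++ (x ∷ xs) ys g = trans (+-congˡ (ΣL-++ xs ys g)) (sym (+-assoc _ _ _))

  ΣL-map : ∀ {A B : Set} (h : A → B) (xs : List A) g → ΣL (map h xs) g ≡ ΣL xs (g ∘ h)
  ΣL-map h [] g = P.refl
  ΣL-map h (x ∷ xs) g = cong (g (h x) +_) (ΣL-map h xs g)

  ΣL-concatMap : ∀ {A B : Set} (Fm : A → List B) (xs : List A) g → ΣL (concatMap Fm xs) g ≈ ΣL xs (λ x → ΣL (Fm x) g)
  ΣL-concatMap Fm [] g = refl
  ΣL-concatMap Fm (x ∷ xs) g = trans (ΣL-++ (Fm x) (concatMap Fm xs) g) (+-congˡ (ΣL-concatMap Fm xs g))

  ΣL-cong : ∀ {A : Set} (xs : List A) {g g' : A → Carrier} → (∀ x → g x ≈ g' x) → ΣL xs g ≈ ΣL xs g'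
  ΣL-cong [] h = refl
  ΣL-cong (x ∷ xs) h = +-cong (h x) (ΣL-cong xs h)

  ΣL-+ : ∀ {A : Set} (xs : List A) g h → ΣL xs (λ x → g x + h x) ≈ ΣL xs g + ΣL xs h
  ΣL-+ [] g h = sym (+-identityˡ 0#)
  ΣL-+ (x ∷ xs) g h = trans (+-congˡ (ΣL-+ xs g h))
    (zsolve 4 (λ a b c d → (a ⊞ b) ⊞ (c ⊞ d) ⩦ (a ⊞ c) ⊞ (b ⊞ d)) refl _ _ _ _)

  ΣL-* : ∀ {A : Set} (xs : List A) a g → a * ΣL xs g ≈ ΣL xs (λ x → a * g x)
  ΣL-* [] a g = zeroʳ a
  ΣL-* (x ∷ xs) a g = trans (distribˡ a _ _) (+-congˡ (ΣL-* xs a g))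

  ΣL-0 : ∀ {A : Set} (xs : List A) → ΣL xs (λ _ → 0#) ≈ 0#
  ΣL-0 [] = refl
  ΣL-0 (x ∷ xs) = trans (+-identityˡ _) (ΣL-0 xs)

  ΣL-swap : ∀ {A B : Set} (xs : List A) (ys : List B) (G : A → B → Carrier) →
    ΣL xs (λ x → ΣL ys (G x)) ≈ ΣL ys (λ y → ΣL xs (λ x → G x y))
  ΣL-swap [] ys G = sym (ΣL-0 ys)
  ΣL-swap (x ∷ xs) ys G = trans (+-congˡ (ΣL-swap xs ys G)) (sym (ΣL-+ ys (G x) (λ y → ΣL xs (λ x → G x y))))

  ΣL-filter : ∀ {A : Set} {p : Level} {Pr : A → Set p} (P? : (x : A) → Dec (Pr x)) (xs : List A) g →
    ΣL (filter P? xs) g ≈ ΣL xs (λ x → if does (P? x) then g x else 0#)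
  ΣL-filter P? [] g = refl
  ΣL-filter P? (x ∷ xs) g with does (P? x)
  ... | true = +-congˡ (ΣL-filter P? xs g)
  ... | false = trans (ΣL-filter P? xs g) (sym (+-identityˡ _))

  ΣL-allVtx-suc : ∀ q n (G : Vtx q (suc n) → Carrier) → ΣL (allVtx q (suc n)) G ≈ ΣFin q (λ c → ΣL (allVtx q n) (G ∘ cons c))
  ΣL-allVtx-suc q n G = trans (ΣL-concatMap (λ a → map (cons a) (allVtx q n)) (allFin q) G)
    (trans (ΣL-cong (allFin q) (λ a → reflexive (ΣL-map (cons a) (allVtx q n) G)))
           (reflexive (ΣL-tab q (λ x → x) (λ a → ΣL (allVtx q n) (G ∘ cons a)))))

  ΣFin-cong : ∀ m {g g' : Fin m → Carrier} → (∀ c → g c ≈ g' c) → ΣFin m g ≈ ΣFin m g'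
  ΣFin-cong zero h = refl
  ΣFin-cong (suc m) h = +-cong (h zero) (ΣFin-cong m (h ∘ suc))

  ΣFin-const : ∀ m z → ΣFin m (λ _ → z) ≈ fromℕ m * z
  ΣFin-const zero z = sym (zeroˡ z)
  ΣFin-const (suc m) z = trans (+-congˡ (ΣFin-const m z)) (sym (trans (distribʳ z 1# (fromℕ m)) (+-congʳ (*-identityˡ z))))

  ΣFin-one : ∀ m (x : Fin m) (K : Bool → Carrier) → ΣFin m (λ c → K (c == x)) ≈ K true + fromℕ (m ∸ 1) * K false
  ΣFin-one (suc m) zero K = +-congˡ (ΣFin-const m (K false))
  ΣFin-one (suc (suc m)) (suc x) K = begin
    K false + ΣFin (suc m) (λ c → K (suc c == suc x)) ≈⟨ +-congˡ (ΣFin-cong (suc m) (λ c → reflexive (cong K (==-suc c x)))) ⟩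
    K false + ΣFin (suc m) (λ c → K (c == x)) ≈⟨ +-congˡ (ΣFin-one (suc m) x K) ⟩
    K false + (K true + fromℕ m * K false) ≈⟨ zsolve 3 (λ a b z → a ⊞ (b ⊞ z ⊠ a) ⩦ b ⊞ (κ (ℤ.+ 1) ⊞ z) ⊠ a) refl (K false) (K true) (fromℕ m) ⟩
    K true + (fromℤ (ℤ.+ 1) + fromℕ m) * K false ≈⟨ +-congˡ (*-congʳ (+-congʳ (+-identityʳ 1#))) ⟩
    K true + fromℕ (suc m) * K false ∎

  distinct⇒2≤ : ∀ {m} (x y : Fin m) → ¬ x ≡ y → 2 ≤ m
  distinct⇒2≤ zero zero ne = ⊥-elim (ne P.refl)
  distinct⇒2≤ {suc (suc m)} zero (suc y) ne = s≤s (s≤s z≤n)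
  distinct⇒2≤ {suc (suc m)} (suc x) y ne = s≤s (s≤s z≤n)

  ΣFin-two : ∀ m (x y : Fin m) → ¬ x ≡ y → (K : Bool → Bool → Carrier) →
    ΣFin m (λ c → K (c == x) (c == y)) ≈ K true false + K false true + fromℕ (m ∸ 2) * K false false
  ΣFin-two (suc m) zero zero ne K = ⊥-elim (ne P.refl)
  ΣFin-two (suc m) zero (suc y) ne K = begin
    K true false + ΣFin m (λ c → K false (suc c == suc y)) ≈⟨ +-congˡ (ΣFin-cong m (λ c → reflexive (cong (K false) (==-suc c y)))) ⟩
    K true false + ΣFin m (λ c → K false (c == y)) ≈⟨ +-congˡ (ΣFin-one m y (K false)) ⟩
    K true false + (K false true + fromℕ (m ∸ 1) * K false false) ≈⟨ sym (+-assoc _ _ _) ⟩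
    K true false + K false true + fromℕ (m ∸ 1) * K false false ∎
  ΣFin-two (suc m) (suc x) zero ne K = begin
    K false true + ΣFin m (λ c → K (suc c == suc x) false) ≈⟨ +-congˡ (ΣFin-cong m (λ c → reflexive (cong (λ b → K b false) (==-suc c x)))) ⟩
    K false true + ΣFin m (λ c → K (c == x) false) ≈⟨ +-congˡ (ΣFin-one m x (λ b → K b false)) ⟩
    K false true + (K true false + fromℕ (m ∸ 1) * K false false) ≈⟨ zsolve 3 (λ a b c → a ⊞ (b ⊞ c) ⩦ b ⊞ a ⊞ c) refl _ _ _ ⟩
    K true false + K false true + fromℕ (m ∸ 1) * K false false ∎
  ΣFin-two (suc m) (suc x) (suc y) ne K with distinct⇒2≤ x y (λ e → ne (cong suc e))
  ... | s≤s (s≤s _) = begin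
    K false false + ΣFin m (λ c → K (suc c == suc x) (suc c == suc y)) ≈⟨ +-congˡ (ΣFin-cong m (λ c → reflexive (cong₂ K (==-suc c x) (==-suc c y)))) ⟩
    K false false + ΣFin m (λ c → K (c == x) (c == y)) ≈⟨ +-congˡ (ΣFin-two m x y (λ e → ne (cong suc e)) K) ⟩
    K false false + (K true false + K false true + fromℕ (m ∸ 2) * K false false) ≈⟨ zsolve 4 (λ z a b w → z ⊞ (a ⊞ b ⊞ w ⊠ z) ⩦ a ⊞ b ⊞ (κ (ℤ.+ 1) ⊞ w) ⊠ z) refl (K false false) (K true false) (K false true) (fromℕ (m ∸ 2)) ⟩
    K true false + K false true + (fromℤ (ℤ.+ 1) + fromℕ (m ∸ 2)) * K false false ≈⟨ +-congˡ (*-congʳ (+-congʳ (+-identityʳ 1#))) ⟩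
    K true false + K false true + fromℕ (suc m ∸ 2) * K false false ∎

  ΣFin-coordinate : ∀ q (g a : Fin q) (U V Φ : ℕ → Carrier) →
    (a ≡ g → U 0 + fromℕ (q ∸ 1) * V 1 ≈ Φ 0) →
    (¬ a ≡ g → U 1 + V 0 + fromℕ (q ∸ 2) * V 1 ≈ Φ 1) →
    ΣFin q (λ c → if c == g then U (mismatch (c == a)) else V (mismatch (c == a))) ≈ Φ (mismatch (a == g))
  ΣFin-coordinate q g a U V Φ same different with g F.≟ a
  ... | yes P.refl = begin
    ΣFin q (λ c → if c == g then U (mismatch (c == g)) else V (mismatch (c == g)))
      ≈⟨ ΣFin-one q g (λ b → if b then U (mismatch b) else V (mismatch b)) ⟩
    U 0 + fromℕ (q ∸ 1) * V 1 ≈⟨ same P.refl ⟩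
    Φ 0                       ≡⟨ cong (Φ ∘ mismatch) (P.sym (==-refl g)) ⟩
    Φ (mismatch (g == g)) ∎
  ... | no g≢a = begin
    ΣFin q (λ c → if c == g then U (mismatch (c == a)) else V (mismatch (c == a)))
      ≈⟨ ΣFin-two q g a g≢a (λ b₁ b₂ → if b₁ then U (mismatch b₂) else V (mismatch b₂)) ⟩
    U 1 + V 0 + fromℕ (q ∸ 2) * V 1 ≈⟨ different (λ e → g≢a (P.sym e)) ⟩
    Φ 1                             ≡⟨ cong (Φ ∘ mismatch) (P.sym (==-false a g (λ e → g≢a (P.sym e)))) ⟩
    Φ (mismatch (a == g)) ∎

  ΣFin-pick : ∀ q (g a : Fin q) (H : ℕ → Carrier) → ΣFin q (λ c → if c == g then H (mismatch (c == a)) else 0#) ≈ H (mismatch (a == g))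
  ΣFin-pick q g a H = ΣFin-coordinate q g a H (λ _ → 0#) H
    (λ _ → trans (+-congˡ (zeroʳ _)) (+-identityʳ _))
    (λ _ → trans (+-cong (+-identityʳ _) (zeroʳ _)) (+-identityʳ _))

  sphereSum : ∀ (q : ℕ) (e n : ℕ) → Subset n → Vtx q n → Vtx q n → (ℕ → ℕ → Carrier) → Carrier
  sphereSum q e n I α γ φ = ΣL (allVtx q n) (λ β → if (dist β γ ℕ.≡ᵇ e) then φ (distOn I α β) (distOn (∁ I) α β) else 0#)

  sphereSum-0 : ∀ q n (I : Subset n) (α γ : Vtx q n) φ → sphereSum q 0 n I α γ φ ≈ φ (distOn I α γ) (distOn (∁ I) α γ)
  sphereSum-0 q zero [] α γ φ = +-identityʳ _
  sphereSum-0 q (suc n) (true ∷ I) α γ φ = trans (ΣL-allVtx-suc q n _) (trans (ΣFin-cong q rest) (ΣFin-pick q (γ zero) (α zero) H))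
    where
    H : ℕ → Carrier
    H s = φ (s ℕ.+ distOn I (α ∘ suc) (γ ∘ suc)) (distOn (∁ I) (α ∘ suc) (γ ∘ suc))
    rest : ∀ c → ΣL (allVtx q n) (λ β' → if (mismatch (c == γ zero) ℕ.+ dist β' (γ ∘ suc) ℕ.≡ᵇ 0) then φ (mismatch (α zero == c) ℕ.+ distOn I (α ∘ suc) β') (distOn (∁ I) (α ∘ suc) β') else 0#)
              ≈ (if c == γ zero then H (mismatch (c == α zero)) else 0#)
    rest c with c == γ zero
    ... | true = trans (sphereSum-0 q n I (α ∘ suc) (γ ∘ suc) (λ u v → φ (mismatch (α zero == c) ℕ.+ u) v)) (reflexive (cong (λ b → H (mismatch b)) (==-sym (α zero) c)))
    ... | false = ΣL-0 (allVtx q n)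
  sphereSum-0 q (suc n) (false ∷ I) α γ φ = trans (ΣL-allVtx-suc q n _) (trans (ΣFin-cong q rest) (ΣFin-pick q (γ zero) (α zero) H))
    where
    H : ℕ → Carrier
    H s = φ (distOn I (α ∘ suc) (γ ∘ suc)) (s ℕ.+ distOn (∁ I) (α ∘ suc) (γ ∘ suc))
    rest : ∀ c → ΣL (allVtx q n) (λ β' → if (mismatch (c == γ zero) ℕ.+ dist β' (γ ∘ suc) ℕ.≡ᵇ 0) then φ (distOn I (α ∘ suc) β') (mismatch (α zero == c) ℕ.+ distOn (∁ I) (α ∘ suc) β') else 0#)
              ≈ (if c == γ zero then H (mismatch (c == α zero)) else 0#)
    rest c with c == γ zero
    ... | true = trans (sphereSum-0 q n I (α ∘ suc) (γ ∘ suc) (λ u v → φ u (mismatch (α zero == c) ℕ.+ v))) (reflexive (cong (λ b → H (mismatch b)) (==-sym (α zero) c)))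
    ... | false = ΣL-0 (allVtx q n)

  -- The local operator L = L_I + L_∁I: on a profile (a, b) with
  -- |I| = k and |∁I| = m, a neighbour of β changes a by -1 (a ways), keeps it
  -- ((q-2)a ways) or raises it by 1 ((q-1)(k-a) ways); similarly for b.
  localI : ℕ → ℕ → (ℕ → ℕ → Carrier) → ℕ → ℕ → Carrier
  localI q k φ a b = fromℕ a * φ (a ∸ 1) b + fromℕ ((q ∸ 2) ℕ.* a) * φ a b + fromℕ ((q ∸ 1) ℕ.* (k ∸ a)) * φ (suc a) b
  local∁I : ℕ → ℕ → (ℕ → ℕ → Carrier) → ℕ → ℕ → Carrier
  local∁I q m φ a b = fromℕ b * φ a (b ∸ 1) + fromℕ ((q ∸ 2) ℕ.* b) * φ a b + fromℕ ((q ∸ 1) ℕ.* (m ∸ b)) * φ a (suc b)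
  localOp : ℕ → ℕ → ℕ → (ℕ → ℕ → Carrier) → ℕ → ℕ → Carrier
  localOp q k m φ a b = localI q k φ a b + local∁I q m φ a b

  fromℕ-*suc : ∀ c z → fromℕ (c ℕ.* suc z) ≈ fromℕ c + fromℕ (c ℕ.* z)
  fromℕ-*suc c z = trans (reflexive (cong fromℕ (ℕP.*-suc c z))) (fromℕ-+ c (c ℕ.* z))

  fromℕ-pred-absorb : ∀ (A : ℕ) (g : ℕ → Carrier) → fromℕ A * g (suc (A ∸ 1)) ≈ fromℕ A * g A
  fromℕ-pred-absorb zero g = trans (zeroˡ _) (sym (zeroˡ _))
  fromℕ-pred-absorb (suc A) g = refl

  -- How L changes when a coordinate is added to I (k ↦ k+1) at which γ agrees with
  -- α ("fixed") or differs from α ("moved"); likewise for ∁I.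
  grow-I-fixed : ∀ q k m φ A B → A ≤ k → localOp q k m φ A B + fromℕ (q ∸ 1) * φ (suc A) B ≈ localOp q (suc k) m φ A B
  grow-I-fixed q k m φ A B le = begin
    (X1 + X2 + fromℕ (c1 ℕ.* (k ∸ A)) * Y + local∁I q m φ A B) + fromℕ c1 * Y
      ≈⟨ zsolve 6 (λ x1 x2 z y tb c → (x1 ⊞ x2 ⊞ z ⊠ y ⊞ tb) ⊞ c ⊠ y ⩦ x1 ⊞ x2 ⊞ (c ⊞ z) ⊠ y ⊞ tb) refl X1 X2 (fromℕ (c1 ℕ.* (k ∸ A))) Y (local∁I q m φ A B) (fromℕ c1) ⟩
    X1 + X2 + (fromℕ c1 + fromℕ (c1 ℕ.* (k ∸ A))) * Y + local∁I q m φ A B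
      ≈⟨ +-congʳ (+-congˡ (*-congʳ (sym (trans (reflexive (cong (λ z → fromℕ (c1 ℕ.* z)) (ℕP.+-∸-assoc 1 le))) (fromℕ-*suc c1 (k ∸ A)))))) ⟩
    localOp q (suc k) m φ A B ∎
    where
    c1 = q ∸ 1
    X1 = fromℕ A * φ (A ∸ 1) B
    X2 = fromℕ ((q ∸ 2) ℕ.* A) * φ A B
    Y = φ (suc A) B

  grow-∁I-fixed : ∀ q k m φ A B → B ≤ m → localOp q k m φ A B + fromℕ (q ∸ 1) * φ A (suc B) ≈ localOp q k (suc m) φ A B
  grow-∁I-fixed q k m φ A B le = begin
    (localI q k φ A B + (X1 + X2 + fromℕ (c1 ℕ.* (m ∸ B)) * Y)) + fromℕ c1 * Y
      ≈⟨ zsolve 6 (λ x1 x2 z y ta c → (ta ⊞ (x1 ⊞ x2 ⊞ z ⊠ y)) ⊞ c ⊠ y ⩦ ta ⊞ (x1 ⊞ x2 ⊞ (c ⊞ z) ⊠ y)) refl X1 X2 (fromℕ (c1 ℕ.* (m ∸ B))) Y (localI q k φ A B) (fromℕ c1) ⟩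
    localI q k φ A B + (X1 + X2 + (fromℕ c1 + fromℕ (c1 ℕ.* (m ∸ B))) * Y)
      ≈⟨ +-congˡ (+-congˡ (*-congʳ (sym (trans (reflexive (cong (λ z → fromℕ (c1 ℕ.* z)) (ℕP.+-∸-assoc 1 le))) (fromℕ-*suc c1 (m ∸ B)))))) ⟩
    localOp q k (suc m) φ A B ∎
    where
    c1 = q ∸ 1
    X1 = fromℕ B * φ A (B ∸ 1)
    X2 = fromℕ ((q ∸ 2) ℕ.* B) * φ A B
    Y = φ A (suc B)

  grow-I-moved : ∀ q k m φ A B → localOp q k m (λ u v → φ (suc u) v) A B + φ A B + fromℕ (q ∸ 2) * φ (suc A) B ≈ localOp q (suc k) m φ (suc A) B
  grow-I-moved q k m φ A B = begin
    (fromℕ A * φ (suc (A ∸ 1)) B + fromℕ (c2 ℕ.* A) * Y + Z3 + TBv) + V + fromℕ c2 * Y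
      ≈⟨ +-congʳ (+-congʳ (+-congʳ (+-congʳ (+-congʳ (fromℕ-pred-absorb A (λ a → φ a B)))))) ⟩
    (fromℕ A * V + fromℕ (c2 ℕ.* A) * Y + Z3 + TBv) + V + fromℕ c2 * Y
      ≈⟨ zsolve 7 (λ a v w y local-at-0 tb c → (a ⊠ v ⊞ w ⊠ y ⊞ local-at-0 ⊞ tb) ⊞ v ⊞ c ⊠ y ⩦ (κ (ℤ.+ 1) ⊞ a) ⊠ v ⊞ (c ⊞ w) ⊠ y ⊞ local-at-0 ⊞ tb) refl
           (fromℕ A) V (fromℕ (c2 ℕ.* A)) Y Z3 TBv (fromℕ c2) ⟩
    (fromℤ (ℤ.+ 1) + fromℕ A) * V + (fromℕ c2 + fromℕ (c2 ℕ.* A)) * Y + Z3 + TBv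
      ≈⟨ +-congʳ (+-congʳ (+-cong (*-congʳ (+-congʳ (+-identityʳ 1#))) (*-congʳ (sym (fromℕ-*suc c2 A))))) ⟩
    localOp q (suc k) m φ (suc A) B ∎
    where
    c2 = q ∸ 2
    V = φ A B
    Y = φ (suc A) B
    Z3 = fromℕ ((q ∸ 1) ℕ.* (k ∸ A)) * φ (suc (suc A)) B
    TBv = local∁I q m φ (suc A) B

  grow-∁I-moved : ∀ q k m φ A B → localOp q k m (λ u v → φ u (suc v)) A B + φ A B + fromℕ (q ∸ 2) * φ A (suc B) ≈ localOp q k (suc m) φ A (suc B)
  grow-∁I-moved q k m φ A B = begin
    (TAv + (fromℕ B * φ A (suc (B ∸ 1)) + fromℕ (c2 ℕ.* B) * Y + Z3)) + V + fromℕ c2 * Y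
      ≈⟨ +-congʳ (+-congʳ (+-congˡ (+-congʳ (+-congʳ (fromℕ-pred-absorb B (λ b → φ A b)))))) ⟩
    (TAv + (fromℕ B * V + fromℕ (c2 ℕ.* B) * Y + Z3)) + V + fromℕ c2 * Y
      ≈⟨ zsolve 7 (λ a v w y local-at-0 ta c → (ta ⊞ (a ⊠ v ⊞ w ⊠ y ⊞ local-at-0)) ⊞ v ⊞ c ⊠ y ⩦ ta ⊞ ((κ (ℤ.+ 1) ⊞ a) ⊠ v ⊞ (c ⊞ w) ⊠ y ⊞ local-at-0)) refl
           (fromℕ B) V (fromℕ (c2 ℕ.* B)) Y Z3 TAv (fromℕ c2) ⟩
    TAv + ((fromℤ (ℤ.+ 1) + fromℕ B) * V + (fromℕ c2 + fromℕ (c2 ℕ.* B)) * Y + Z3)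
      ≈⟨ +-congˡ (+-congʳ (+-cong (*-congʳ (+-congʳ (+-identityʳ 1#))) (*-congʳ (sym (fromℕ-*suc c2 B))))) ⟩
    localOp q k (suc m) φ A (suc B) ∎
    where
    c2 = q ∸ 2
    V = φ A B
    Y = φ A (suc B)
    Z3 = fromℕ ((q ∸ 1) ℕ.* (m ∸ B)) * φ A (suc (suc B))
    TAv = localI q k φ A (suc B)

  sphereSum-1 : ∀ q n (I : Subset n) (α γ : Vtx q n) φ → sphereSum q 1 n I α γ φ ≈ localOp q (∣ I ∣) (∣ ∁ I ∣) φ (distOn I α γ) (distOn (∁ I) α γ)
  sphereSum-1 q zero [] α γ φ = trans (+-identityʳ 0#) (sym (trans (+-cong (local-at-0 _ _ _) (local-at-0 _ _ _)) (+-identityʳ 0#)))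
    where
    local-at-0 : ∀ x y w → fromℕ 0 * x + fromℕ ((q ∸ 2) ℕ.* 0) * y + fromℕ ((q ∸ 1) ℕ.* 0) * w ≈ 0#
    local-at-0 x y w = trans (+-cong (+-cong (zeroˡ _) (trans (*-congʳ (reflexive (cong fromℕ (ℕP.*-zeroʳ (q ∸ 2))))) (zeroˡ _)))
                       (trans (*-congʳ (reflexive (cong fromℕ (ℕP.*-zeroʳ (q ∸ 1))))) (zeroˡ _)))
               (trans (+-identityʳ _) (+-identityʳ _))
  sphereSum-1 q (suc n) (true ∷ I) α γ φ = trans (ΣL-allVtx-suc q n _) (trans (ΣFin-cong q rest) first-coordinate)
    where
    A' = distOn I (α ∘ suc) (γ ∘ suc)
    B' = distOn (∁ I) (α ∘ suc) (γ ∘ suc)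
    U : ℕ → Carrier
    U s = localOp q (∣ I ∣) (∣ ∁ I ∣) (λ u v → φ (s ℕ.+ u) v) A' B'
    V : ℕ → Carrier
    V s = φ (s ℕ.+ A') B'
    rest : ∀ c → ΣL (allVtx q n) (λ β' → if (mismatch (c == γ zero) ℕ.+ dist β' (γ ∘ suc) ℕ.≡ᵇ 1) then φ (mismatch (α zero == c) ℕ.+ distOn I (α ∘ suc) β') (distOn (∁ I) (α ∘ suc) β') else 0#)
              ≈ (if c == γ zero then U (mismatch (c == α zero)) else V (mismatch (c == α zero)))
    rest c with c == γ zero
    ... | true = trans (sphereSum-1 q n I (α ∘ suc) (γ ∘ suc) (λ u v → φ (mismatch (α zero == c) ℕ.+ u) v)) (reflexive (cong (λ b → U (mismatch b)) (==-sym (α zero) c)))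
    ... | false = trans (sphereSum-0 q n I (α ∘ suc) (γ ∘ suc) (λ u v → φ (mismatch (α zero == c) ℕ.+ u) v)) (reflexive (cong (λ b → V (mismatch b)) (==-sym (α zero) c)))
    first-coordinate : ΣFin q (λ c → if c == γ zero then U (mismatch (c == α zero)) else V (mismatch (c == α zero))) ≈ localOp q (suc ∣ I ∣) (∣ ∁ I ∣) φ (mismatch (α zero == γ zero) ℕ.+ A') B'
    first-coordinate = ΣFin-coordinate q (γ zero) (α zero) U V (λ s → localOp q (suc ∣ I ∣) (∣ ∁ I ∣) φ (s ℕ.+ A') B')
            (λ _ → grow-I-fixed q (∣ I ∣) (∣ ∁ I ∣) φ A' B' (distOn≤ I (α ∘ suc) (γ ∘ suc)))
            (λ _ → grow-I-moved q (∣ I ∣) (∣ ∁ I ∣) φ A' B')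
  sphereSum-1 q (suc n) (false ∷ I) α γ φ = trans (ΣL-allVtx-suc q n _) (trans (ΣFin-cong q rest) first-coordinate)
    where
    A' = distOn I (α ∘ suc) (γ ∘ suc)
    B' = distOn (∁ I) (α ∘ suc) (γ ∘ suc)
    U : ℕ → Carrier
    U s = localOp q (∣ I ∣) (∣ ∁ I ∣) (λ u v → φ u (s ℕ.+ v)) A' B'
    V : ℕ → Carrier
    V s = φ A' (s ℕ.+ B')
    rest : ∀ c → ΣL (allVtx q n) (λ β' → if (mismatch (c == γ zero) ℕ.+ dist β' (γ ∘ suc) ℕ.≡ᵇ 1) then φ (distOn I (α ∘ suc) β') (mismatch (α zero == c) ℕ.+ distOn (∁ I) (α ∘ suc) β') else 0#)
              ≈ (if c == γ zero then U (mismatch (c == α zero)) else V (mismatch (c == α zero)))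
    rest c with c == γ zero
    ... | true = trans (sphereSum-1 q n I (α ∘ suc) (γ ∘ suc) (λ u v → φ u (mismatch (α zero == c) ℕ.+ v))) (reflexive (cong (λ b → U (mismatch b)) (==-sym (α zero) c)))
    ... | false = trans (sphereSum-0 q n I (α ∘ suc) (γ ∘ suc) (λ u v → φ u (mismatch (α zero == c) ℕ.+ v))) (reflexive (cong (λ b → V (mismatch b)) (==-sym (α zero) c)))
    first-coordinate : ΣFin q (λ c → if c == γ zero then U (mismatch (c == α zero)) else V (mismatch (c == α zero))) ≈ localOp q (∣ I ∣) (suc ∣ ∁ I ∣) φ A' (mismatch (α zero == γ zero) ℕ.+ B')
    first-coordinate = ΣFin-coordinate q (γ zero) (α zero) U V (λ s → localOp q (∣ I ∣) (suc ∣ ∁ I ∣) φ A' (s ℕ.+ B'))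
            (λ _ → grow-∁I-fixed q (∣ I ∣) (∣ ∁ I ∣) φ A' B' (distOn≤ (∁ I) (α ∘ suc) (γ ∘ suc)))
            (λ _ → grow-∁I-moved q (∣ I ∣) (∣ ∁ I ∣) φ A' B')

  profileSum : ∀ q n → Subset n → Vtx q n → (Vtx q n → Carrier) → (ℕ → ℕ → Carrier) → Carrier
  profileSum q n I α f φ = ΣL (allVtx q n) (λ β → φ (distOn I α β) (distOn (∁ I) α β) * f β)

  if-mul : ∀ b x y → x * (if b then y else 0#) ≈ (if b then x else 0#) * y
  if-mul true x y = refl
  if-mul false x y = trans (zeroʳ x) (sym (zeroˡ y))

  ΣL-*r : ∀ {A : Set} (xs : List A) g a → ΣL xs (λ x → g x * a) ≈ ΣL xs g * a
  ΣL-*r xs g a = trans (ΣL-cong xs (λ x → *-comm (g x) a)) (trans (sym (ΣL-* xs a g)) (*-comm a (ΣL xs g)))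

  -- For a λ-function f:  λ · W φ = W (L φ).  Expand λ f(β) as the sum of f over the
  -- neighbours of β, exchange the two sums and apply sphereSum-1.
  profileSum-λ : ∀ q n (I : Subset n) (α : Vtx q n) f λ' φ → IsLambdaFunction λ' f →
        fromℤ λ' * profileSum q n I α f φ ≈ profileSum q n I α f (λ a b → localOp q ∣ I ∣ ∣ ∁ I ∣ φ a b)
  profileSum-λ q n I α f λ' φ isλ = begin
    fromℤ λ' * ΣL L (λ β → φβ β * f β) ≈⟨ ΣL-* L (fromℤ λ') _ ⟩
    ΣL L (λ β → fromℤ λ' * (φβ β * f β)) ≈⟨ ΣL-cong L (λ β → swap-front (fromℤ λ') (φβ β) (f β)) ⟩
    ΣL L (λ β → φβ β * (fromℤ λ' * f β)) ≈⟨ ΣL-cong L (λ β → *-congˡ (sym (isλ β))) ⟩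
    ΣL L (λ β → φβ β * sumW1 f β) ≈⟨ ΣL-cong L (λ β → *-congˡ (trans (ΣL-filter (λ γ → ρ β γ ℕP.≟ 1) L f)
                                        (ΣL-cong L (λ γ → reflexive (cong (λ z → if z ℕ.≡ᵇ 1 then f γ else 0#) (ρ≡dist β γ)))))) ⟩
    ΣL L (λ β → φβ β * ΣL L (λ γ → if dist β γ ℕ.≡ᵇ 1 then f γ else 0#)) ≈⟨ ΣL-cong L (λ β → trans (ΣL-* L (φβ β) _) (ΣL-cong L (λ γ → if-mul (dist β γ ℕ.≡ᵇ 1) (φβ β) (f γ)))) ⟩
    ΣL L (λ β → ΣL L (λ γ → (if dist β γ ℕ.≡ᵇ 1 then φβ β else 0#) * f γ)) ≈⟨ ΣL-swap L L _ ⟩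
    ΣL L (λ γ → ΣL L (λ β → (if dist β γ ℕ.≡ᵇ 1 then φβ β else 0#) * f γ)) ≈⟨ ΣL-cong L (λ γ → ΣL-*r L _ (f γ)) ⟩
    ΣL L (λ γ → sphereSum q 1 n I α γ φ * f γ) ≈⟨ ΣL-cong L (λ γ → *-congʳ (sphereSum-1 q n I α γ φ)) ⟩
    profileSum q n I α f (λ a b → localOp q ∣ I ∣ ∣ ∁ I ∣ φ a b) ∎
    where
    L = allVtx q n
    φβ : Vtx q n → Carrier
    φβ β = φ (distOn I α β) (distOn (∁ I) α β)

  ≡ᵇ-sym : ∀ a b → (a ℕ.≡ᵇ b) ≡ (b ℕ.≡ᵇ a)
  ≡ᵇ-sym zero zero = P.refl
  ≡ᵇ-sym zero (suc b) = P.refl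
  ≡ᵇ-sym (suc a) zero = P.refl
  ≡ᵇ-sym (suc a) (suc b) = ≡ᵇ-sym a b

  -- The defining conditions of v_j^{∁I} and v_i^I are point masses on the profile:
  -- β ∈ Γ^{∁I}(α) with ρ(α,β) = j  iff  the profile of β is (0, j), and
  -- β ∈ Γ^I(α) with ρ(α,β) = i  iff  it is (i, 0).
  coface-indicator : ∀ a b j x → (if (a ℕ.≡ᵇ 0) ∧ (a ℕ.+ b ℕ.≡ᵇ j) then x else 0#) ≈ fromℤ (δℤ 0 a ℤ.* δℤ j b) * x
  coface-indicator (suc a) b j x = sym (zeroˡ x)
  coface-indicator zero b j x rewrite ≡ᵇ-sym b j with j ℕ.≡ᵇ b
  ... | true = sym (trans (*-congʳ (+-identityʳ 1#)) (*-identityˡ x))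
  ... | false = sym (zeroˡ x)

  face-indicator : ∀ a b i x → (if (b ℕ.≡ᵇ 0) ∧ (a ℕ.+ b ℕ.≡ᵇ i) then x else 0#) ≈ fromℤ (δℤ i a ℤ.* δℤ 0 b) * x
  face-indicator a (suc b) i x = sym (trans (*-congʳ (reflexive (cong fromℤ (ℤP.*-zeroʳ (δℤ i a))))) (zeroˡ x))
  face-indicator a zero i x rewrite ℕP.+-identityʳ a | ≡ᵇ-sym a i with i ℕ.≡ᵇ a
  ... | true = sym (trans (*-congʳ (+-identityʳ 1#)) (*-identityˡ x))
  ... | false = sym (zeroˡ x)

  v-coface : ∀ q n (I : Subset n) (α : Vtx q n) f j → v j (∁ I) f α ≈ profileSum q n I α f (λ a b → fromℤ (δℤ 0 a ℤ.* δℤ j b))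
  v-coface q n I α f j = trans (ΣL-filter (λ β → (inFace (∁ I) α β ∧ ⌊ ρ α β ℕP.≟ j ⌋) BoolP.≟ true) (allVtx q n) f)
    (ΣL-cong (allVtx q n) (λ β → trans (reflexive (cong (λ z → if z then f β else 0#) (eqB β))) (coface-indicator (distOn I α β) (distOn (∁ I) α β) j (f β))))
    where
    eqB : ∀ β → does ((inFace (∁ I) α β ∧ ⌊ ρ α β ℕP.≟ j ⌋) BoolP.≟ true) ≡ (distOn I α β ℕ.≡ᵇ 0) ∧ (distOn I α β ℕ.+ distOn (∁ I) α β ℕ.≡ᵇ j)
    eqB β = P.trans (does≟true _) (cong₂ _∧_ (P.trans (inFace≡allT (∁ I) α β) (inFace-∁ I α β))
              (P.trans (isYes≗does (ρ α β ℕP.≟ j)) (cong (ℕ._≡ᵇ j) (P.trans (ρ≡dist α β) (dist-split I α β)))))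

  v-face : ∀ q n (I : Subset n) (α : Vtx q n) f i → v i I f α ≈ profileSum q n I α f (λ a b → fromℤ (δℤ i a ℤ.* δℤ 0 b))
  v-face q n I α f i = trans (ΣL-filter (λ β → (inFace I α β ∧ ⌊ ρ α β ℕP.≟ i ⌋) BoolP.≟ true) (allVtx q n) f)
    (ΣL-cong (allVtx q n) (λ β → trans (reflexive (cong (λ z → if z then f β else 0#) (eqB β))) (face-indicator (distOn I α β) (distOn (∁ I) α β) i (f β))))
    where
    eqB : ∀ β → does ((inFace I α β ∧ ⌊ ρ α β ℕP.≟ i ⌋) BoolP.≟ true) ≡ (distOn (∁ I) α β ℕ.≡ᵇ 0) ∧ (distOn I α β ℕ.+ distOn (∁ I) α β ℕ.≡ᵇ i)
    eqB β = P.trans (does≟true _) (cong₂ _∧_ (P.trans (inFace≡allT I α β) (inFace-self I α β))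
              (P.trans (isYes≗does (ρ α β ℕP.≟ i)) (cong (ℕ._≡ᵇ i) (P.trans (ρ≡dist α β) (dist-split I α β)))))

module Spectral {c ℓ : Level} (R : CommutativeRing c ℓ) where

  open import Data.Nat as ℕ using (ℕ; zero; suc; _∸_; z≤n; s≤s; _≤_; _<_)
  import Data.Nat.Properties as ℕP
  open import Data.Integer as ℤ using (ℤ)
  import Data.Integer.Properties as ℤP
  open import Data.Integer.Solver using (module +-*-Solver)
  open import Data.Fin.Subset using (Subset; ∁; ∣_∣)
  import Data.Fin.Subset.Properties as SubsetP
  open import Data.Sum using (inj₁; inj₂; [_,_])
  open import Relation.Binary.PropositionalEquality as P using (_≡_; cong; cong₂)
  import Relation.Binary.Reasoning.Setoid as SetoidReasoning
  open import Relation.Nullary using (¬_)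
  open import Defs
  open CommutativeRing R hiding (zero)
  open RingToolkit R hiding (solve; _:+_; _:*_; :-_; _:=_)
  open HammingDistance using (distOn≤)
  open HammingSums R using (profileSum; localOp; profileSum-λ; v-coface; v-face; ΣL-cong; ΣL-+; ΣL-*)
  open Krawtchouk using (δℤ; eigval; Kraw-recurrence; Kraw-orthogonality)
  open Rearrangements R using (swap-front)
  private
    module IS = +-*-Solver
    module ≈-Reasoning = SetoidReasoning setoid

  localOpℤ : ℕ → ℕ → ℕ → (ℕ → ℕ → ℤ) → ℕ → ℕ → ℤ
  localOpℤ q k m F a b =
      (ℤ.+ a ℤ.* F (a ∸ 1) b ℤ.+ ℤ.+ ((q ∸ 2) ℕ.* a) ℤ.* F a b ℤ.+ ℤ.+ ((q ∸ 1) ℕ.* (k ∸ a)) ℤ.* F (suc a) b)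
    ℤ.+ (ℤ.+ b ℤ.* F a (b ∸ 1) ℤ.+ ℤ.+ ((q ∸ 2) ℕ.* b) ℤ.* F a b ℤ.+ ℤ.+ ((q ∸ 1) ℕ.* (m ∸ b)) ℤ.* F a (suc b))

  -- K_u(a;k) K_s(b;m) is an eigenfunction of the local operator with eigenvalue
  -- eigval q k u + eigval q m s: the recurrence applies in each variable separately.
  KrawProduct-eigen : ∀ q k m u s a b → 2 ≤ q → a ≤ k → b ≤ m →
    localOpℤ q k m (λ a b → Kraw q u a k ℤ.* Kraw q s b m) a b ≡ (eigval q k u ℤ.+ eigval q m s) ℤ.* (Kraw q u a k ℤ.* Kraw q s b m)
  KrawProduct-eigen q k m u s a b q≥2 a≤k b≤m = begin
    localOpℤ q k m (λ a b → Kraw q u a k ℤ.* Kraw q s b m) a b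
      ≡⟨ IS.solve 12 (λ x₁ x₂ x₃ p₋ p p₊ y₁ y₂ y₃ q₋ q₀ q₊ →
           (x₁ :* (p₋ :* q₀) :+ x₂ :* (p :* q₀) :+ x₃ :* (p₊ :* q₀)) :+ (y₁ :* (p :* q₋) :+ y₂ :* (p :* q₀) :+ y₃ :* (p :* q₊))
           := (x₁ :* p₋ :+ x₂ :* p :+ x₃ :* p₊) :* q₀ :+ p :* (y₁ :* q₋ :+ y₂ :* q₀ :+ y₃ :* q₊)) P.refl
           (ℤ.+ a) (ℤ.+ ((q ∸ 2) ℕ.* a)) (ℤ.+ ((q ∸ 1) ℕ.* (k ∸ a))) (Kraw q u (a ∸ 1) k) (Kraw q u a k) (Kraw q u (suc a) k)
           (ℤ.+ b) (ℤ.+ ((q ∸ 2) ℕ.* b)) (ℤ.+ ((q ∸ 1) ℕ.* (m ∸ b))) (Kraw q s (b ∸ 1) m) (Kraw q s b m) (Kraw q s (suc b) m) ⟩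
    (ℤ.+ a ℤ.* Kraw q u (a ∸ 1) k ℤ.+ ℤ.+ ((q ∸ 2) ℕ.* a) ℤ.* Kraw q u a k ℤ.+ ℤ.+ ((q ∸ 1) ℕ.* (k ∸ a)) ℤ.* Kraw q u (suc a) k) ℤ.* Kraw q s b m
      ℤ.+ Kraw q u a k ℤ.* (ℤ.+ b ℤ.* Kraw q s (b ∸ 1) m ℤ.+ ℤ.+ ((q ∸ 2) ℕ.* b) ℤ.* Kraw q s b m ℤ.+ ℤ.+ ((q ∸ 1) ℕ.* (m ∸ b)) ℤ.* Kraw q s (suc b) m)
      ≡⟨ cong₂ (λ x y → x ℤ.* Kraw q s b m ℤ.+ Kraw q u a k ℤ.* y) (Kraw-recurrence q k a u q≥2 a≤k) (Kraw-recurrence q m b s q≥2 b≤m) ⟩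
    (eigval q k u ℤ.* Kraw q u a k) ℤ.* Kraw q s b m ℤ.+ Kraw q u a k ℤ.* (eigval q m s ℤ.* Kraw q s b m)
      ≡⟨ IS.solve 4 (λ μ p ν p′ → (μ :* p) :* p′ :+ p :* (ν :* p′) := (μ :+ ν) :* (p :* p′)) P.refl
           (eigval q k u) (Kraw q u a k) (eigval q m s) (Kraw q s b m) ⟩
    (eigval q k u ℤ.+ eigval q m s) ℤ.* (Kraw q u a k ℤ.* Kraw q s b m) ∎
    where
    open IS
    open P.≡-Reasoning

  localOp-fromℤ : ∀ q k m (F : ℕ → ℕ → ℤ) a b → localOp q k m (λ a b → fromℤ (F a b)) a b ≈ fromℤ (localOpℤ q k m F a b)
  localOp-fromℤ q k m F a b = sym (trans (fromℤ-+ (x₁ ℤ.* F (a ∸ 1) b ℤ.+ x₂ ℤ.* F a b ℤ.+ x₃ ℤ.* F (suc a) b)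
                                                  (y₁ ℤ.* F a (b ∸ 1) ℤ.+ y₂ ℤ.* F a b ℤ.+ y₃ ℤ.* F a (suc b)))
    (+-cong (fromℤ-three x₁ (F (a ∸ 1) b) x₂ (F a b) x₃ (F (suc a) b)) (fromℤ-three y₁ (F a (b ∸ 1)) y₂ (F a b) y₃ (F a (suc b)))))
    where
    x₁ = ℤ.+ a
    x₂ = ℤ.+ ((q ∸ 2) ℕ.* a)
    x₃ = ℤ.+ ((q ∸ 1) ℕ.* (k ∸ a))
    y₁ = ℤ.+ b
    y₂ = ℤ.+ ((q ∸ 2) ℕ.* b)
    y₃ = ℤ.+ ((q ∸ 1) ℕ.* (m ∸ b))
    fromℤ-three : ∀ x₁ z₁ x₂ z₂ x₃ z₃ →
      fromℤ (x₁ ℤ.* z₁ ℤ.+ x₂ ℤ.* z₂ ℤ.+ x₃ ℤ.* z₃) ≈ fromℤ x₁ * fromℤ z₁ + fromℤ x₂ * fromℤ z₂ + fromℤ x₃ * fromℤ z₃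
    fromℤ-three x₁ z₁ x₂ z₂ x₃ z₃ = trans (fromℤ-+ (x₁ ℤ.* z₁ ℤ.+ x₂ ℤ.* z₂) (x₃ ℤ.* z₃))
      (+-cong (trans (fromℤ-+ (x₁ ℤ.* z₁) (x₂ ℤ.* z₂)) (+-cong (fromℤ-* x₁ z₁) (fromℤ-* x₂ z₂))) (fromℤ-* x₃ z₃))

  module ProfileSums (q n : ℕ) (I : Subset n) (α : Vtx q n) (f : Vtx q n → Carrier) where
    private
      W = profileSum q n I α f

    W-box : ∀ {φ ψ : ℕ → ℕ → Carrier} → (∀ a b → a ≤ ∣ I ∣ → b ≤ ∣ ∁ I ∣ → φ a b ≈ ψ a b) → W φ ≈ W ψ
    W-box e = ΣL-cong (allVtx q n) (λ β → *-congʳ (e _ _ (distOn≤ I α β) (distOn≤ (∁ I) α β)))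

    W-+ : ∀ (φ ψ : ℕ → ℕ → Carrier) → W (λ a b → φ a b + ψ a b) ≈ W φ + W ψ
    W-+ φ ψ = trans (ΣL-cong (allVtx q n) (λ β → distribʳ _ _ _)) (ΣL-+ (allVtx q n) _ _)

    W-scal : ∀ x (φ : ℕ → ℕ → Carrier) → W (λ a b → x * φ a b) ≈ x * W φ
    W-scal x φ = trans (ΣL-cong (allVtx q n) (λ β → *-assoc _ _ _)) (sym (ΣL-* (allVtx q n) x _))

    W-Σ : ∀ N (G : ℕ → ℕ → ℕ → Carrier) → W (λ a b → ΣR N (λ u → G u a b)) ≈ ΣR N (λ u → W (G u))
    W-Σ zero G = refl
    W-Σ (suc N) G = trans (W-+ (λ a b → ΣR N (λ u → G u a b)) (G (suc N))) (+-congʳ (W-Σ N G))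

  powℤ-+ : ∀ q k → powℤ (ℤ.+ q) k ≡ ℤ.+ (q ℕ.^ k)
  powℤ-+ q zero = P.refl
  powℤ-+ q (suc k) = P.trans (cong (ℤ.+ q ℤ.*_) (powℤ-+ q k)) (P.sym (ℤP.pos-* q (q ℕ.^ k)))

  powℤ≢0 : ∀ q k → 1 ≤ q → ¬ powℤ (ℤ.+ q) k ≡ ℤ.0ℤ
  powℤ≢0 q k 1≤q e = ℕP.<⇒≢ 1≤q (P.sym (ℕP.m^n≡0⇒m≡0 q k (ℤP.+-injective (P.trans (P.sym (powℤ-+ q k)) e))))

  module Setting (tf : TorsionFree) (q n h : ℕ) (q>2 : 2 < q) (h≤n : h ≤ n) (f : Vtx q n → Carrier)
                 (isλ : IsLambdaFunction (lam q n h) f) (I : Subset n) (k≤h : ∣ I ∣ ≤ h) (k≤n∸h : ∣ I ∣ ≤ n ∸ h)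
                 (α : Vtx q n) where

    open ProfileSums q n I α f

    k m : ℕ
    k = ∣ I ∣
    m = ∣ ∁ I ∣

    m≡n∸k : m ≡ n ∸ k
    m≡n∸k = SubsetP.∣∁p∣≡n∸∣p∣ I

    n≡k+m : n ≡ k ℕ.+ m
    n≡k+m = P.trans (P.sym (ℕP.m+[n∸m]≡n (SubsetP.∣p∣≤n I))) (cong (k ℕ.+_) (P.sym m≡n∸k))

    q≥2 : 2 ≤ q
    q≥2 = ℕP.<⇒≤ q>2

    q≥1 : 1 ≤ q
    q≥1 = ℕP.≤-trans (s≤s z≤n) q≥2

    W : (ℕ → ℕ → Carrier) → Carrier
    W = profileSum q n I α f

    KK : ℕ → ℕ → ℕ → ℕ → Carrier
    KK u s a b = fromℤ (Kraw q u a k ℤ.* Kraw q s b m)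

    component : ℕ → ℕ → Carrier
    component u s = W (KK u s)

    λ-gap : ∀ u s → lam q n h ℤ.- (eigval q k u ℤ.+ eigval q m s) ≡ ℤ.+ q ℤ.* (ℤ.+ (u ℕ.+ s) ℤ.- ℤ.+ h)
    λ-gap u s = P.trans (cong₂ ℤ._-_ (cong₂ ℤ._-_ (qn≡ n≡k+m) (ℤP.pos-* q h))
                          (cong₂ ℤ._+_ (cong₂ ℤ._-_ (ℤP.pos-* (q ∸ 1) k) (ℤP.pos-* q u)) (cong₂ ℤ._-_ (ℤP.pos-* (q ∸ 1) m) (ℤP.pos-* q s))))
                (P.trans (IS.solve 7 (λ c K M Q H U S → c IS.:* (K IS.:+ M) IS.:- Q IS.:* H IS.:- ((c IS.:* K IS.:- Q IS.:* U) IS.:+ (c IS.:* M IS.:- Q IS.:* S))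
                                                         IS.:= Q IS.:* ((U IS.:+ S) IS.:- H)) P.refl
                           (ℤ.+ (q ∸ 1)) (ℤ.+ k) (ℤ.+ m) (ℤ.+ q) (ℤ.+ h) (ℤ.+ u) (ℤ.+ s))
                         (cong (λ z → ℤ.+ q ℤ.* (z ℤ.- ℤ.+ h)) (P.sym (ℤP.pos-+ u s))))
      where
      qn≡ : ∀ {N} → N ≡ k ℕ.+ m → ℤ.+ ((q ∸ 1) ℕ.* N) ≡ ℤ.+ (q ∸ 1) ℤ.* (ℤ.+ k ℤ.+ ℤ.+ m)
      qn≡ P.refl = P.trans (ℤP.pos-* (q ∸ 1) (k ℕ.+ m)) (cong (ℤ.+ (q ∸ 1) ℤ.*_) (ℤP.pos-+ k m))

    λ-gap≢0 : ∀ u s → ¬ (u ℕ.+ s ≡ h) → ¬ (lam q n h ℤ.- (eigval q k u ℤ.+ eigval q m s) ≡ ℤ.0ℤ)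
    λ-gap≢0 u s u+s≢h e with ℤP.i*j≡0⇒i≡0∨j≡0 (ℤ.+ q) (P.trans (P.sym (λ-gap u s)) e)
    ... | inj₁ q≡0 = ℕP.<⇒≢ q≥1 (P.sym (ℤP.+-injective q≡0))
    ... | inj₂ d≡0 = u+s≢h (ℤP.+-injective (ℤP.i-j≡0⇒i≡j _ _ d≡0))

    component-eigen : ∀ u s → fromℤ (lam q n h) * component u s ≈ fromℤ (eigval q k u ℤ.+ eigval q m s) * component u s
    component-eigen u s = begin
      fromℤ (lam q n h) * component u s          ≈⟨ profileSum-λ q n I α f (lam q n h) (KK u s) isλ ⟩
      W (λ a b → localOp q k m (KK u s) a b)     ≈⟨ W-box (λ a b a≤k b≤m → trans (localOp-fromℤ q k m (λ a b → Kraw q u a k ℤ.* Kraw q s b m) a b)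
                                                     (trans (reflexive (cong fromℤ (KrawProduct-eigen q k m u s a b q≥2 a≤k b≤m))) (fromℤ-* μ _))) ⟩
      W (λ a b → fromℤ μ * KK u s a b)           ≈⟨ W-scal (fromℤ μ) (KK u s) ⟩
      fromℤ μ * component u s ∎
      where
      open ≈-Reasoning
      μ = eigval q k u ℤ.+ eigval q m s

    component-vanishes : ∀ u s → ¬ (u ℕ.+ s ≡ h) → component u s ≈ 0#
    component-vanishes u s u+s≢h = torsionFree-ℤ tf (lam q n h ℤ.- μ) (component u s) (λ-gap≢0 u s u+s≢h) (begin
      fromℤ (lam q n h ℤ.- μ) * component u s
        ≈⟨ *-congʳ (trans (fromℤ-+ (lam q n h) (ℤ.- μ)) (+-congˡ (fromℤ-neg μ))) ⟩
      (fromℤ (lam q n h) - fromℤ μ) * component u s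
        ≈⟨ trans (distribʳ _ _ _) (+-congˡ (sym (-‿distribˡ-* _ _))) ⟩
      fromℤ (lam q n h) * component u s - fromℤ μ * component u s
        ≈⟨ +-congʳ (component-eigen u s) ⟩
      fromℤ μ * component u s - fromℤ μ * component u s
        ≈⟨ -‿inverseʳ _ ⟩
      0# ∎)
      where
      open ≈-Reasoning
      μ = eigval q k u ℤ.+ eigval q m s

    h≤m : h ≤ m
    h≤m = P.subst (h ≤_) (P.sym m≡n∸k) (ℕP.m+n≤o⇒m≤o∸n h (P.subst (_≤ n) (ℕP.+-comm k h) (ℕP.m≤o∸n⇒m+n≤o k h≤n k≤n∸h)))

    qᵏqᵐ : ℤ
    qᵏqᵐ = powℤ (ℤ.+ q) k ℤ.* powℤ (ℤ.+ q) m

    qᵏqᵐ≢0 : ¬ qᵏqᵐ ≡ ℤ.0ℤ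
    qᵏqᵐ≢0 e = [ powℤ≢0 q k q≥1 , powℤ≢0 q m q≥1 ] (ℤP.i*j≡0⇒i≡0∨j≡0 (powℤ (ℤ.+ q) k) e)

    δ² : ℕ → ℕ → ℕ → ℕ → ℤ
    δ² a₀ b₀ a b = δℤ a₀ a ℤ.* δℤ b₀ b

    -- Orthogonality in both variables expands q^k q^m δ² through the eigenfunctions.
    δ²-as-Kraw-sum : ∀ a₀ b₀ a b → a ≤ k → b ≤ m →
      fromℤ qᵏqᵐ * fromℤ (δ² a₀ b₀ a b) ≈ ΣR k (λ u → ΣR m (λ s → fromℤ (Kraw q a₀ u k ℤ.* Kraw q b₀ s m) * KK u s a b))
    δ²-as-Kraw-sum a₀ b₀ a b a≤k b≤m = sym (begin
      ΣR k (λ u → ΣR m (λ s → fromℤ (A u ℤ.* B s) * fromℤ (C u ℤ.* D s)))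
        ≈⟨ ΣR-cong k (λ u _ → ΣR-cong m (λ s _ → trans (sym (fromℤ-* (A u ℤ.* B s) (C u ℤ.* D s)))
             (trans (reflexive (cong fromℤ (interchange (A u) (B s) (C u) (D s)))) (fromℤ-* (A u ℤ.* C u) (B s ℤ.* D s))))) ⟩
      ΣR k (λ u → ΣR m (λ s → fromℤ (A u ℤ.* C u) * fromℤ (B s ℤ.* D s)))
        ≈⟨ ΣR-cong k (λ u _ → sym (ΣR-* m (fromℤ (A u ℤ.* C u)) _)) ⟩
      ΣR k (λ u → fromℤ (A u ℤ.* C u) * ΣR m (λ s → fromℤ (B s ℤ.* D s)))
        ≈⟨ ΣR-*r k _ _ ⟩
      ΣR k (λ u → fromℤ (A u ℤ.* C u)) * ΣR m (λ s → fromℤ (B s ℤ.* D s))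
        ≈⟨ *-cong (sym (fromℤ-Σ k _)) (sym (fromℤ-Σ m _)) ⟩
      fromℤ (Σℤ k (λ u → A u ℤ.* C u)) * fromℤ (Σℤ m (λ s → B s ℤ.* D s))
        ≈⟨ reflexive (cong₂ (λ x y → fromℤ x * fromℤ y) (Kraw-orthogonality q k a₀ a q≥1 a≤k) (Kraw-orthogonality q m b₀ b q≥1 b≤m)) ⟩
      fromℤ (powℤ (ℤ.+ q) k ℤ.* δℤ a₀ a) * fromℤ (powℤ (ℤ.+ q) m ℤ.* δℤ b₀ b)
        ≈⟨ trans (sym (fromℤ-* (powℤ (ℤ.+ q) k ℤ.* δℤ a₀ a) (powℤ (ℤ.+ q) m ℤ.* δℤ b₀ b))) (reflexive (cong fromℤ (interchange (powℤ (ℤ.+ q) k) (δℤ a₀ a) (powℤ (ℤ.+ q) m) (δℤ b₀ b)))) ⟩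
      fromℤ (qᵏqᵐ ℤ.* δ² a₀ b₀ a b)
        ≈⟨ fromℤ-* qᵏqᵐ (δ² a₀ b₀ a b) ⟩
      fromℤ qᵏqᵐ * fromℤ (δ² a₀ b₀ a b) ∎)
      where
      open ≈-Reasoning
      A = λ u → Kraw q a₀ u k
      B = λ s → Kraw q b₀ s m
      C = λ u → Kraw q u a k
      D = λ s → Kraw q s b m
      interchange : ∀ w x y z → (w ℤ.* x) ℤ.* (y ℤ.* z) ≡ (w ℤ.* y) ℤ.* (x ℤ.* z)
      interchange = IS.solve 4 (λ w x y z → (w IS.:* x) IS.:* (y IS.:* z) IS.:= (w IS.:* y) IS.:* (x IS.:* z)) P.refl

    δ²-expansion : ∀ a₀ b₀ → fromℤ qᵏqᵐ * W (λ a b → fromℤ (δ² a₀ b₀ a b))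
                           ≈ ΣR k (λ u → fromℤ (Kraw q a₀ u k ℤ.* Kraw q b₀ (h ∸ u) m) * component u (h ∸ u))
    δ²-expansion a₀ b₀ = begin
      fromℤ qᵏqᵐ * W (λ a b → fromℤ (δ² a₀ b₀ a b))                  ≈⟨ W-scal (fromℤ qᵏqᵐ) (λ a b → fromℤ (δ² a₀ b₀ a b)) ⟨
      W (λ a b → fromℤ qᵏqᵐ * fromℤ (δ² a₀ b₀ a b))                  ≈⟨ W-box (δ²-as-Kraw-sum a₀ b₀) ⟩
      W (λ a b → ΣR k (λ u → ΣR m (λ s → fromℤ (κ u s) * KK u s a b))) ≈⟨ W-Σ k (λ u a b → ΣR m (λ s → fromℤ (κ u s) * KK u s a b)) ⟩
      ΣR k (λ u → W (λ a b → ΣR m (λ s → fromℤ (κ u s) * KK u s a b))) ≈⟨ ΣR-cong k (λ u _ → W-Σ m (λ s a b → fromℤ (κ u s) * KK u s a b)) ⟩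
      ΣR k (λ u → ΣR m (λ s → W (λ a b → fromℤ (κ u s) * KK u s a b))) ≈⟨ ΣR-cong k (λ u _ → ΣR-cong m (λ s _ → W-scal (fromℤ (κ u s)) (KK u s))) ⟩
      ΣR k (λ u → ΣR m (λ s → fromℤ (κ u s) * component u s))
        ≈⟨ ΣR-cong k (λ u _ → ΣR-single m (h ∸ u) (ℕP.≤-trans (ℕP.m∸n≤m h u) h≤m)
             (λ s _ s≢h∸u → trans (*-congˡ (component-vanishes u s (λ e → s≢h∸u (P.trans (P.sym (ℕP.m+n∸m≡n u s)) (cong (_∸ u) e))))) (zeroʳ _))) ⟩
      ΣR k (λ u → fromℤ (κ u (h ∸ u)) * component u (h ∸ u)) ∎
      where
      open ≈-Reasoning
      κ = λ u s → Kraw q a₀ u k ℤ.* Kraw q b₀ s m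

    -- The common value of both sides of the theorem, multiplied by q^n.
    commonValue : ℕ → Carrier
    commonValue j = ΣR k (λ u → fromℤ (Kraw q j (h ∸ u) (n ∸ k)) * component u (h ∸ u))

    -- v_j^{∁I}(α) = W δ_{(0,j)} and K_0 = 1.
    coface-expansion : ∀ j → fromℤ qᵏqᵐ * v j (∁ I) f α ≈ commonValue j
    coface-expansion j = trans (*-congˡ (v-coface q n I α f j)) (trans (δ²-expansion 0 j)
      (ΣR-cong k (λ u _ → *-congʳ (reflexive (cong fromℤ (P.trans (ℤP.*-identityˡ (Kraw q j (h ∸ u) m)) (cong (Kraw q j (h ∸ u)) m≡n∸k)))))))

    -- v_i^I(α) = W δ_{(i,0)}, and the reduction identity collapses the sum over i.
    face-expansion : ∀ j → fromℤ qᵏqᵐ * ΣR j (λ i → fromℤ (r q n h k i j) * v i I f α) ≈ commonValue j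
    face-expansion j = begin
      fromℤ qᵏqᵐ * ΣR j (λ i → fromℤ (r′ i) * v i I f α)
        ≈⟨ ΣR-* j (fromℤ qᵏqᵐ) _ ⟩
      ΣR j (λ i → fromℤ qᵏqᵐ * (fromℤ (r′ i) * v i I f α))
        ≈⟨ ΣR-cong j (λ i _ → swap-front (fromℤ qᵏqᵐ) (fromℤ (r′ i)) (v i I f α)) ⟩
      ΣR j (λ i → fromℤ (r′ i) * (fromℤ qᵏqᵐ * v i I f α))
        ≈⟨ ΣR-cong j (λ i _ → *-congˡ (trans (*-congˡ (v-face q n I α f i)) (δ²-expansion i 0))) ⟩
      ΣR j (λ i → fromℤ (r′ i) * ΣR k (λ u → fromℤ (Kraw q i u k ℤ.* Kraw q 0 (h ∸ u) m) * component u (h ∸ u)))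
        ≈⟨ ΣR-cong j (λ i _ → trans (ΣR-* k (fromℤ (r′ i)) _) (ΣR-cong k (λ u _ → absorb i u))) ⟩
      ΣR j (λ i → ΣR k (λ u → fromℤ (r′ i ℤ.* Kraw q i u k) * component u (h ∸ u)))
        ≈⟨ ΣR-swap j k (λ i u → fromℤ (r′ i ℤ.* Kraw q i u k) * component u (h ∸ u)) ⟩
      ΣR k (λ u → ΣR j (λ i → fromℤ (r′ i ℤ.* Kraw q i u k) * component u (h ∸ u)))
        ≈⟨ ΣR-cong k (λ u _ → trans (ΣR-*r j (λ i → fromℤ (r′ i ℤ.* Kraw q i u k)) (component u (h ∸ u)))
                                     (*-congʳ (sym (fromℤ-Σ j (λ i → r′ i ℤ.* Kraw q i u k))))) ⟩
      ΣR k (λ u → fromℤ (Σℤ j (λ i → r′ i ℤ.* Kraw q i u k)) * component u (h ∸ u))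
        ≈⟨ ΣR-cong k (λ u u≤k → *-congʳ (reflexive (cong fromℤ (Reduction.reduction-identity q n h k u j q≥2 u≤k k≤h h≤n k≤n∸h)))) ⟩
      commonValue j ∎
      where
      open ≈-Reasoning
      r′ = λ i → r q n h k i j
      absorb : ∀ i u → fromℤ (r′ i) * (fromℤ (Kraw q i u k ℤ.* Kraw q 0 (h ∸ u) m) * component u (h ∸ u))
                       ≈ fromℤ (r′ i ℤ.* Kraw q i u k) * component u (h ∸ u)
      absorb i u = trans (sym (*-assoc _ _ _)) (*-congʳ (trans (sym (fromℤ-* (r′ i) (Kraw q i u k ℤ.* Kraw q 0 (h ∸ u) m)))
                     (reflexive (cong fromℤ (cong (r′ i ℤ.*_) (ℤP.*-identityʳ (Kraw q i u k)))))))

lemma2 : ∀ {c ℓ} (R : CommutativeRing c ℓ) → WithRing.TorsionFree R →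
    (q n h : ℕ) → 2 < q → 1 ≤ n → h ≤ n →
    (f : Vtx q n → CommutativeRing.Carrier R) →
    WithRing.IsLambdaFunction R (lam q n h) f →
    (I : Subset n) → ∣ I ∣ ≤ h → ∣ I ∣ ≤ n ∸ h →
    (α : Vtx q n) (j : ℕ) → j ≤ n ∸ ∣ I ∣ →
    CommutativeRing._≈_ R (WithRing.v R j (∁ I) f α)
    (WithRing.ΣR R j (λ i → CommutativeRing._*_ R
    (WithRing.fromℤ R (r q n h ∣ I ∣ i j)) (WithRing.v R i I f α)))
lemma2 R tf q n h q>2 _ h≤n f isλ I k≤h k≤n∸h α j _ =
  cancel-ℤ tf qᵏqᵐ qᵏqᵐ≢0 (begin
    fromℤ qᵏqᵐ * v j (∁ I) f α                                    ≈⟨ coface-expansion j ⟩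
    commonValue j                                                 ≈⟨ face-expansion j ⟨
    fromℤ qᵏqᵐ * ΣR j (λ i → fromℤ (r q n h ∣ I ∣ i j) * v i I f α) ∎)
  where
  open CommutativeRing R using (_*_; setoid)
  open RingToolkit R using (cancel-ℤ; fromℤ; v; ΣR)
  open Spectral.Setting R tf q n h q>2 h≤n f isλ I k≤h k≤n∸h α
  open import Relation.Binary.Reasoning.Setoid setoid
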